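{- There is a formula $\varphi(X,Y,Z)$ of MSO+$\nabla$ such that for every family of pairwise disjoint intervals $\mathcal{I}$ and every set of nodes $Z$, $\varphi(\mathrm{source}(\mathcal{I}),\mathrm{target}(\mathcal{I}),Z)$ is true in the full binary tree if and only if $Z$ is a characteristic of $\mathcal{I}$, i.e. $\mathbb{P}\big[\{\pi : (\pi\text{ contains infinitely many nodes of }Z) \iff \limsup\mathcal{I}(\pi)=\infty\}\big]=1$.
   Context: The full binary tree has node set $\{0,1\}^*$, ancestor order $\le$ the prefix relation. MSO has node and set-of-nodes variables, atoms $x\in X$, $x\le y$, $x=y0$, $x=y1$, Boolean connectives and quantifiers. A branch is an element of $\{0,1\}^\omega$, identified with its set of finite prefixes; $\mathbb{P}$ is the coin-tossing measure (complete probability measure on $\{0,1\}^\omega$ with $\mathbb{P}[x\{0,1\}^\omega]=2^{ -|x|}$). MSO+$\nabla$ adds branch variables, atoms $x\in\pi$, and the quantifier $\nabla\pi.\,\varphi(\pi)$, true iff some $R\subseteq\{0,1\}^\omega$ with $\mathbb{P}(R)=1$ has all its branches satisfying $\varphi$. An interval is $[x,y]=\{z:x\le z\le y\}$ for $x<y$, with source $x$, target $y$, and length $|\{z: x<z<y\}|$. A family of intervals $\mathcal{I}$ is a set of pairwise disjoint intervals, with $\mathrm{source}(\mathcal{I})$, $\mathrm{target}(\mathcal{I})$ the sets of sources and targets. $\mathcal{I}(\pi)$ is the sequence of lengths of the intervals of $\mathcal{I}$ whose sources lie on the branch $\pi$, ordered by increasing depth of the source; $\limsup\mathcal{I}(\pi)=\infty$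 means this sequence is unbounded. -}

module Defs where

open import Level using (Level; 0ℓ) renaming (suc to lsuc)
open import Data.Bool using (Bool; true; false)
open import Data.List using (List; []; _∷_; _++_; length)
open import Data.Nat using (ℕ; zero; suc; _≤_; _∸_; _≟_)
open import Data.Rational using (ℚ; 0ℚ; 1ℚ; ½; _+_; _*_) renaming (_≤_ to _≤ℚ_)
open import Data.Product using (Σ; ∃; _×_; _,_)
open import Data.Sum using (_⊎_)
open import Relation.Nullary using (¬_; yes; no)
open import Relation.Binary.PropositionalEquality using (_≡_; _≢_)

-- The full binary tree: nodes are finite words over {0,1}
-- (false = 0, true = 1).  Child x0 is x ++ [0], x1 is x ++ [1].

Node : Set
Node = List Bool

-- ancestor order = prefix relation
_⊑_ : Node → Node → Set
x ⊑ y = Σ Node λ w → y ≡ x ++ w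

_⊏_ : Node → Node → Set
x ⊏ y = x ⊑ y × x ≢ y

depth : Node → ℕ
depth = length

-- Branches: infinite words, identified with their sets of finite prefixes

Branch : Set
Branch = ℕ → Bool

prefix : Branch → ℕ → Node
prefix π zero    = []
prefix π (suc n) = π 0 ∷ prefix (λ i → π (suc i)) n

_∈B_ : Node → Branch → Set
x ∈B π = x ≡ prefix π (length x)

-- The coin-tossing measure, via (outer-measure-)null sets.
-- P[x{0,1}^ω] = 2^{-|x|}.

halfPow : ℕ → ℚ
halfPow zero    = 1ℚ
halfPow (suc n) = ½ * halfPow n

partialMass : (ℕ → Node) → ℕ → ℚ
partialMass c zero    = 0ℚ
partialMass c (suc n) = partialMass c n + halfPow (length (c n))

-- N is P-null (outer measure 0): for every k it is covered by a countable
-- family of cylinders of total measure ≤ 2^{-k}.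
Null : (Branch → Set) → Set
Null N = (k : ℕ) → Σ (ℕ → Node) λ c →
           ((π : Branch) → N π → Σ ℕ λ i → c i ∈B π)
         × ((n : ℕ) → partialMass c n ≤ℚ halfPow k)

-- For the complete measure P:  P(R) = 1  iff  the complement of R is null.
ProbOne : (Branch → Set) → Set
ProbOne R = Null (λ π → ¬ R π)

-- MSO+∇ : syntax (variables of each sort are indexed by ℕ)

data Formula : Set where
  _∈ˢ_  : (x X : ℕ) → Formula
  _≤ⁿ_  : (x y : ℕ) → Formula
  child0 : (x y : ℕ) → Formula
  child1 : (x y : ℕ) → Formula
  _∈ᵇ_  : (x p : ℕ) → Formula
  ¬'_   : Formula → Formula
  _∧'_  : Formula → Formula → Formula
  _∨'_  : Formula → Formula → Formula
  ∃ⁿ ∀ⁿ : ℕ → Formula → Formula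
  ∃ˢ ∀ˢ : ℕ → Formula → Formula
  ∇     : ℕ → Formula → Formula

record Env : Set₁ where
  field
    nodeV   : ℕ → Node
    setV    : ℕ → Node → Set
    branchV : ℕ → Branch
open Env public

upd : ∀ {A : Set₁} → (ℕ → A) → ℕ → A → ℕ → A
upd f i a j with i ≟ j
... | yes _ = a
... | no  _ = f j

updN : ∀ {A : Set} → (ℕ → A) → ℕ → A → ℕ → A
updN f i a j with i ≟ j
... | yes _ = a
... | no  _ = f j

_[n_↦_] : Env → ℕ → Node → Env
ρ [n i ↦ x ] = record ρ { nodeV = updN (nodeV ρ) i x }

_[s_↦_] : Env → ℕ → (Node → Set) → Env
ρ [s i ↦ X ] = record ρ { setV = upd (setV ρ) i X }

_[b_↦_] : Env → ℕ → Branch → Env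
ρ [b i ↦ π ] = record ρ { branchV = updN (branchV ρ) i π }

⟦_⟧ : Formula → Env → Set₁
⟦ x ∈ˢ X ⟧ ρ     = Level.Lift _ (setV ρ X (nodeV ρ x))
⟦ x ≤ⁿ y ⟧ ρ     = Level.Lift _ (nodeV ρ x ⊑ nodeV ρ y)
⟦ child0 x y ⟧ ρ = Level.Lift _ (nodeV ρ x ≡ nodeV ρ y ++ (false ∷ []))
⟦ child1 x y ⟧ ρ = Level.Lift _ (nodeV ρ x ≡ nodeV ρ y ++ (true ∷ []))
⟦ x ∈ᵇ p ⟧ ρ     = Level.Lift _ (nodeV ρ x ∈B branchV ρ p)
⟦ ¬' φ ⟧ ρ       = ¬ ⟦ φ ⟧ ρ
⟦ φ ∧' ψ ⟧ ρ     = ⟦ φ ⟧ ρ × ⟦ ψ ⟧ ρ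
⟦ φ ∨' ψ ⟧ ρ     = ⟦ φ ⟧ ρ ⊎ ⟦ ψ ⟧ ρ
⟦ ∃ⁿ i φ ⟧ ρ     = Σ Node λ x → ⟦ φ ⟧ (ρ [n i ↦ x ])
⟦ ∀ⁿ i φ ⟧ ρ     = (x : Node) → ⟦ φ ⟧ (ρ [n i ↦ x ])
⟦ ∃ˢ i φ ⟧ ρ     = Σ (Node → Set) λ X → ⟦ φ ⟧ (ρ [s i ↦ X ])
⟦ ∀ˢ i φ ⟧ ρ     = (X : Node → Set) → ⟦ φ ⟧ (ρ [s i ↦ X ])
⟦ ∇ p φ ⟧ ρ      = Σ (Branch → Set) λ R → ProbOne R
                     × ((π : Branch) → R π → ⟦ φ ⟧ (ρ [b p ↦ π ]))

-- Intervals and families of intervals.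
-- A family is given by the relation  I x y  :⇔  [x,y] ∈ 𝓘.

InInterval : Node → Node → Node → Set
InInterval x y z = x ⊑ z × z ⊑ y

IntervalFamily : (Node → Node → Set) → Set
IntervalFamily I =
    ((x y : Node) → I x y → x ⊏ y)
  × ((x y x' y' : Node) → I x y → I x' y' →
       (x ≡ x' × y ≡ y') ⊎ ¬ (Σ Node λ z → InInterval x y z × InInterval x' y' z))

source : (Node → Node → Set) → Node → Set
source I x = Σ Node λ y → I x y

target : (Node → Node → Set) → Node → Set
target I y = Σ Node λ x → I x y

-- length of [x,y] = |{z : x < z < y}| = |y| - |x| - 1
intervalLength : Node → Node → ℕ
intervalLength x y = length y ∸ suc (length x)

-- limsup 𝓘(π) = ∞ : the lengths of intervals with source on π are unbounded
LimsupInfinite : (Node → Node → Set) → Branch → Set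
LimsupInfinite I π = (m : ℕ) → Σ Node λ x → Σ Node λ y →
                       I x y × x ∈B π × m ≤ intervalLength x y

InfinitelyMany : (Node → Set) → Branch → Set
InfinitelyMany Z π = (n : ℕ) → Σ ℕ λ m → n ≤ m × Z (prefix π m)

Characteristic : (Node → Node → Set) → (Node → Set) → Set
Characteristic I Z = ProbOne (λ π →
  (InfinitelyMany Z π → LimsupInfinite I π) × (LimsupInfinite I π → InfinitelyMany Z π))

module Submission where

-- For a set W of nodes and a branch π let
--   HI_W(π) : π meets sources of 𝓘 lying in W below each of its nodes,
--   FC_W(π) : below some node of π, no interval with source in W lies on π
--             (only finitely many W-intervals are completed along π),
--   Z∞(π)   : π meets Z below each of its nodes,
-- all first-order expressible from the sources and targets of 𝓘, and put
--   φ  :=  (∀W. ∇π. HI_W ∧ FC_W → Z∞)  ∧  (∃W. ∇π. Z∞ → HI_W ∧ FC_W).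
-- Three facts make φ express "Z is a characteristic of 𝓘":
--   (A) for every W, almost surely  HI_W ∧ FC_W → limsup 𝓘(π) = ∞;
--   (B) for a suitable "greedy" set G, almost surely FC_G;
--   (C) for the same G, always  limsup 𝓘(π) = ∞ → HI_G.
-- The almost-sure facts are proved with supermartingales: a set on which a
-- nonnegative supermartingale starting at ≤ 1 is unbounded is null (Ville,
-- via Kraft's inequality), and the supermartingales are the values of a
-- betting machine that bets for (B) or against (A) the intervals it meets.

open import Defs
open import Level using (0ℓ) renaming (suc to lsuc)
open import Axiom.ExcludedMiddle using (ExcludedMiddle)
open import Data.Product using (Σ; _,_)
open import Function.Bundles using (_⇔_; mk⇔)

module Dyadic where

  open import Data.Nat as ℕ using (ℕ; zero; suc)
  import Data.Nat.Properties as ℕP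
  open import Data.Rational using (ℚ; 0ℚ; 1ℚ; ½; _+_; _*_; _-_; -_; _≤_; nonNegative)
  open import Data.Rational.Properties
  open import Relation.Binary.PropositionalEquality
  open import Data.Rational.Solver
  open +-*-Solver

  scaleˡ : ∀ {a b} c → 0ℚ ≤ c → a ≤ b → c * a ≤ c * b
  scaleˡ c p q = *-monoˡ-≤-nonNeg c {{nonNegative p}} q

  scaleʳ : ∀ {a b} c → 0ℚ ≤ c → a ≤ b → a * c ≤ b * c
  scaleʳ c p q = *-monoʳ-≤-nonNeg c {{nonNegative p}} q

  *-mono-nonNeg : ∀ {a b c d} → 0ℚ ≤ a → 0ℚ ≤ c → a ≤ b → c ≤ d → a * c ≤ b * d
  *-mono-nonNeg {a} {b} {c} {d} na nc ab cd = ≤-trans (scaleˡ a na cd) (scaleʳ d (≤-trans nc cd) ab)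

  nonNeg-* : ∀ {a b} → 0ℚ ≤ a → 0ℚ ≤ b → 0ℚ ≤ a * b
  nonNeg-* {a} {b} p q = ≤-trans (≤-reflexive (sym (*-zeroʳ a))) (scaleˡ a p q)

  nonNeg-+ : ∀ {a b} → 0ℚ ≤ a → 0ℚ ≤ b → 0ℚ ≤ a + b
  nonNeg-+ p q = +-mono-≤ p q

  0≤1 : 0ℚ ≤ 1ℚ
  0≤1 = ≤ᵇ⇒≤ _

  0≤½ : 0ℚ ≤ ½
  0≤½ = ≤ᵇ⇒≤ _

  0≤2 : 0ℚ ≤ 1ℚ + 1ℚ
  0≤2 = ≤ᵇ⇒≤ _

  ≤-+nonNeg : ∀ {a} b → 0ℚ ≤ b → a ≤ a + b
  ≤-+nonNeg {a} b p = ≤-trans (≤-reflexive (sym (+-identityʳ a))) (+-mono-≤ (≤-refl {a}) p)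

  nonNeg-∸ : ∀ {a b} → a ≤ b → 0ℚ ≤ b - a
  nonNeg-∸ {a} {b} p = ≤-trans (≤-reflexive (sym (+-inverseʳ a))) (+-mono-≤ p (≤-refl { - a}))

  -∸-anti : ∀ {a b} c → a ≤ b → c - b ≤ c - a
  -∸-anti c p = +-mono-≤ (≤-refl {c}) (neg-antimono-≤ p)

  halve : ∀ a → ½ * a + ½ * a ≡ a
  halve = solve 1 (λ a → con ½ :* a :+ con ½ :* a := a) refl

  half≤ : ∀ a → 0ℚ ≤ a → ½ * a ≤ a
  half≤ a p = ≤-trans (≤-+nonNeg (½ * a) (nonNeg-* 0≤½ p)) (≤-reflexive (halve a))

  halfPow-nonNeg : ∀ n → 0ℚ ≤ halfPow n
  halfPow-nonNeg zero = 0≤1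
  halfPow-nonNeg (suc n) = nonNeg-* 0≤½ (halfPow-nonNeg n)

  halfPow-split : ∀ n → halfPow (suc n) + halfPow (suc n) ≡ halfPow n
  halfPow-split n = halve (halfPow n)

  halfPow≤1 : ∀ n → halfPow n ≤ 1ℚ
  halfPow≤1 zero = ≤-refl
  halfPow≤1 (suc n) = ≤-trans (scaleˡ ½ 0≤½ (halfPow≤1 n)) (≤ᵇ⇒≤ _)

  halfPow-anti : ∀ {m n} → m ℕ.≤ n → halfPow n ≤ halfPow m
  halfPow-anti {zero} {n} _ = halfPow≤1 n
  halfPow-anti {suc m} {suc n} (ℕ.s≤s l) = scaleˡ ½ 0≤½ (halfPow-anti l)

  twoPow : ℕ → ℚ
  twoPow zero = 1ℚ
  twoPow (suc n) = (1ℚ + 1ℚ) * twoPow n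

  twoPow-nonNeg : ∀ n → 0ℚ ≤ twoPow n
  twoPow-nonNeg zero = 0≤1
  twoPow-nonNeg (suc n) = nonNeg-* 0≤2 (twoPow-nonNeg n)

  twoPow*halfPow : ∀ n → twoPow n * halfPow n ≡ 1ℚ
  twoPow*halfPow zero = refl
  twoPow*halfPow (suc n) =
    trans (solve 2 (λ t a → (con 1ℚ :+ con 1ℚ) :* t :* (con ½ :* a) := t :* a) refl (twoPow n) (halfPow n))
          (twoPow*halfPow n)

  half-twoPow : ∀ n → ½ * twoPow (suc n) ≡ twoPow n
  half-twoPow n = solve 1 (λ t → con ½ :* ((con 1ℚ :+ con 1ℚ) :* t) := t) refl (twoPow n)

  twoPow-+ : ∀ a b → twoPow (a ℕ.+ b) ≡ twoPow a * twoPow b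
  twoPow-+ zero b = sym (*-identityˡ (twoPow b))
  twoPow-+ (suc a) b = trans (cong ((1ℚ + 1ℚ) *_) (twoPow-+ a b)) (sym (*-assoc (1ℚ + 1ℚ) (twoPow a) (twoPow b)))

  halfPow*twoPow : ∀ a b → halfPow a * twoPow (a ℕ.+ b) ≡ twoPow b
  halfPow*twoPow a b = begin
    halfPow a * twoPow (a ℕ.+ b)        ≡⟨ cong (halfPow a *_) (twoPow-+ a b) ⟩
    halfPow a * (twoPow a * twoPow b)   ≡⟨ solve 3 (λ x t u → x :* (t :* u) := (t :* x) :* u) refl (halfPow a) (twoPow a) (twoPow b) ⟩
    (twoPow a * halfPow a) * twoPow b   ≡⟨ cong (_* twoPow b) (twoPow*halfPow a) ⟩
    1ℚ * twoPow b                       ≡⟨ *-identityˡ (twoPow b) ⟩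
    twoPow b                            ∎
    where open ≡-Reasoning

  twoPow-mono : ∀ {j k} → j ℕ.≤ k → twoPow j ≤ twoPow k
  twoPow-mono {j} {k} j≤k = begin
    twoPow j                         ≤⟨ ≤-+nonNeg (twoPow j * (twoPow d - 1ℚ)) (nonNeg-* (twoPow-nonNeg j) (nonNeg-∸ (one≤twoPow d))) ⟩
    twoPow j + twoPow j * (twoPow d - 1ℚ) ≡⟨ solve 2 (λ t u → t :+ t :* (u :- con 1ℚ) := t :* u) refl (twoPow j) (twoPow d) ⟩
    twoPow j * twoPow d              ≡⟨ sym (twoPow-+ j d) ⟩
    twoPow (j ℕ.+ d)                 ≡⟨ cong twoPow (ℕP.m+[n∸m]≡n j≤k) ⟩
    twoPow k                         ∎
    where
    open ≤-Reasoning
    d : ℕ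
    d = k ℕ.∸ j
    one≤twoPow : ∀ n → 1ℚ ≤ twoPow n
    one≤twoPow zero = ≤-refl
    one≤twoPow (suc n) = ≤-trans (one≤twoPow n)
      (≤-trans (≤-+nonNeg (twoPow n) (twoPow-nonNeg n))
               (≤-reflexive (solve 1 (λ t → t :+ t := (con 1ℚ :+ con 1ℚ) :* t) refl (twoPow n))))

  pow : ℚ → ℕ → ℚ
  pow x zero = 1ℚ
  pow x (suc j) = x * pow x j

  pow-+ : ∀ x m n → pow x (m ℕ.+ n) ≡ pow x m * pow x n
  pow-+ x zero n = sym (*-identityˡ (pow x n))
  pow-+ x (suc m) n = trans (cong (x *_) (pow-+ x m n)) (sym (*-assoc x (pow x m) (pow x n)))

  pow-sq : ∀ x m → pow (x * x) m ≡ pow x m * pow x m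
  pow-sq x zero = sym (*-identityˡ 1ℚ)
  pow-sq x (suc m) = trans (cong (x * x *_) (pow-sq x m))
    (solve 3 (λ x a b → x :* x :* (a :* b) := x :* a :* (x :* b)) refl x (pow x m) (pow x m))

  pow-nonNeg : ∀ {x} j → 0ℚ ≤ x → 0ℚ ≤ pow x j
  pow-nonNeg zero _ = 0≤1
  pow-nonNeg (suc j) p = nonNeg-* p (pow-nonNeg j p)

  pow-mono : ∀ {x y} j → 0ℚ ≤ x → x ≤ y → pow x j ≤ pow y j
  pow-mono zero _ _ = ≤-refl
  pow-mono (suc j) nx xy = *-mono-nonNeg nx (pow-nonNeg j nx) xy (pow-mono j nx xy)

  2^ : ℕ → ℕ
  2^ zero = 1
  2^ (suc a) = 2^ a ℕ.+ 2^ a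

  -- (1 + e)^(2^a) ≥ 2 as soon as e ≥ 2^-a, by repeated squaring:
  -- (1 + e)^2 ≥ 1 + 2e.
  bernoulli-double : ∀ a e → halfPow a ≤ e → 1ℚ + 1ℚ ≤ pow (1ℚ + e) (2^ a)
  bernoulli-double zero e p = ≤-trans (+-mono-≤ (≤-refl {1ℚ}) p) (≤-reflexive (sym (*-identityʳ (1ℚ + e))))
  bernoulli-double (suc a) e p = begin
    1ℚ + 1ℚ                                  ≤⟨ bernoulli-double a (e + e) (≤-trans (≤-reflexive (sym (halfPow-split a))) (+-mono-≤ p p)) ⟩
    pow (1ℚ + (e + e)) (2^ a)               ≤⟨ pow-mono (2^ a) (nonNeg-+ 0≤1 (nonNeg-+ 0≤e 0≤e)) square-bound ⟩
    pow ((1ℚ + e) * (1ℚ + e)) (2^ a)         ≡⟨ pow-sq (1ℚ + e) (2^ a) ⟩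
    pow (1ℚ + e) (2^ a) * pow (1ℚ + e) (2^ a) ≡⟨ sym (pow-+ (1ℚ + e) (2^ a) (2^ a)) ⟩
    pow (1ℚ + e) (2^ (suc a))                ∎
    where
    open ≤-Reasoning
    0≤e : 0ℚ ≤ e
    0≤e = ≤-trans (halfPow-nonNeg (suc a)) p
    square-bound : 1ℚ + (e + e) ≤ (1ℚ + e) * (1ℚ + e)
    square-bound = ≤-trans (≤-+nonNeg (e * e) (nonNeg-* 0≤e 0≤e))
      (≤-reflexive (solve 1 (λ e → con 1ℚ :+ (e :+ e) :+ e :* e := (con 1ℚ :+ e) :* (con 1ℚ :+ e)) refl e))

  bernoulli : ∀ a t → twoPow t ≤ pow (1ℚ + halfPow a) (2^ a ℕ.* t)
  bernoulli a zero rewrite ℕP.*-zeroʳ (2^ a) = ≤-refl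
  bernoulli a (suc t) rewrite ℕP.*-suc (2^ a) t | pow-+ (1ℚ + halfPow a) (2^ a) (2^ a ℕ.* t) =
    *-mono-nonNeg 0≤2 (twoPow-nonNeg t) (bernoulli-double a (halfPow a) ≤-refl) (bernoulli a t)

module Tree where

  open import Data.Bool as Bool using (Bool; true; false; not)
  open import Data.List using ([]; _∷_; _++_; _∷ʳ_; length)
  open import Data.List.Properties using (++-assoc; ++-identityʳ; length-++)
  open import Data.Nat as ℕ using (ℕ; zero; suc; _≤_; _<_; z≤n; s≤s)
  import Data.Nat.Properties as ℕP
  open import Data.Product using (Σ; _×_; _,_; proj₁; proj₂)
  open import Data.Sum using (_⊎_; inj₁; inj₂)
  open import Relation.Nullary using (¬_; Dec; yes; no)
  open import Relation.Binary.PropositionalEquality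

  ⊑-refl : ∀ x → x ⊑ x
  ⊑-refl x = [] , sym (++-identityʳ x)

  ⊑-trans : ∀ {x y z} → x ⊑ y → y ⊑ z → x ⊑ z
  ⊑-trans {x} (w1 , refl) (w2 , refl) = w1 ++ w2 , ++-assoc x w1 w2

  []⊑ : ∀ {x} → [] ⊑ x
  []⊑ {x} = x , refl

  ⊑-++ : ∀ x w → x ⊑ (x ++ w)
  ⊑-++ x w = w , refl

  ⊑-cons : ∀ {x y} b → x ⊑ y → (b ∷ x) ⊑ (b ∷ y)
  ⊑-cons b (w , e) = w , cong (b ∷_) e

  ⊑-uncons : ∀ {b c x y} → (b ∷ x) ⊑ (c ∷ y) → b ≡ c × x ⊑ y
  ⊑-uncons (w , refl) = refl , (w , refl)

  length-∷ʳ : ∀ v (b : Bool) → length (v ∷ʳ b) ≡ suc (length v)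
  length-∷ʳ v b = trans (length-++ v) (ℕP.+-comm (length v) 1)

  ⊑-length : ∀ {x y} → x ⊑ y → length x ≤ length y
  ⊑-length {x} (w , refl) = ℕP.≤-trans (ℕP.m≤m+n (length x) (length w)) (ℕP.≤-reflexive (sym (length-++ x)))

  ⊑-length-≡ : ∀ {x y} → x ⊑ y → length y ≤ length x → x ≡ y
  ⊑-length-≡ {[]} {[]} _ _ = refl
  ⊑-length-≡ {[]} {c ∷ y} _ ()
  ⊑-length-≡ {b ∷ x} {[]} (w , ())
  ⊑-length-≡ {b ∷ x} {c ∷ y} p (s≤s q) with ⊑-uncons p
  ... | refl , p' = cong (b ∷_) (⊑-length-≡ p' q)

  ⊑-antisym : ∀ {x y} → x ⊑ y → y ⊑ x → x ≡ y
  ⊑-antisym p q = ⊑-length-≡ p (⊑-length q)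

  _⊑?_ : (x y : Node) → Dec (x ⊑ y)
  [] ⊑? y = yes []⊑
  (b ∷ x) ⊑? [] = no (λ { (w , ()) })
  (b ∷ x) ⊑? (c ∷ y) with b Bool.≟ c | x ⊑? y
  ... | yes refl | yes p = yes (⊑-cons b p)
  ... | yes refl | no ¬p = no (λ q → ¬p (proj₂ (⊑-uncons q)))
  ... | no b≠c | _ = no (λ q → b≠c (proj₁ (⊑-uncons q)))

  ⊑-comparable : ∀ {x y z} → x ⊑ z → y ⊑ z → x ⊑ y ⊎ y ⊑ x
  ⊑-comparable {[]} _ _ = inj₁ []⊑
  ⊑-comparable {_ ∷ _} {[]} _ _ = inj₂ []⊑
  ⊑-comparable {a ∷ x} {b ∷ y} {[]} (_ , ()) _
  ⊑-comparable {a ∷ x} {b ∷ y} {c ∷ z} p q with ⊑-uncons p | ⊑-uncons q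
  ... | refl , p' | refl , q' with ⊑-comparable p' q'
  ... | inj₁ r = inj₁ (⊑-cons a r)
  ... | inj₂ r = inj₂ (⊑-cons a r)

  childTowards : ∀ {v y} → v ⊑ y → length v < length y →
    Σ Bool λ c → (v ∷ʳ c) ⊑ y × ¬ ((v ∷ʳ not c) ⊑ y)
  childTowards {[]} {[]} _ ()
  childTowards {[]} {c ∷ y} _ _ = c , (y , refl) , λ q → not≢ c (proj₁ (⊑-uncons q))
    where
    not≢ : ∀ c → not c ≢ c
    not≢ false ()
    not≢ true ()
  childTowards {a ∷ v} {[]} (_ , ()) _
  childTowards {a ∷ v} {b ∷ y} p (s≤s l) with ⊑-uncons p
  ... | refl , p' with childTowards p' l
  ... | c , q , nq = c , ⊑-cons a q , λ r → nq (proj₂ (⊑-uncons r))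

  ≤-induction : ∀ {P : ℕ → Set} {n₀} → (∀ n → n₀ ≤ n → P n → P (suc n)) → P n₀ → ∀ m → n₀ ≤ m → P m
  ≤-induction step base zero z≤n = base
  ≤-induction step base (suc m) le with ℕP.m≤n⇒m<n∨m≡n le
  ... | inj₁ (s≤s n₀≤m) = step m n₀≤m (≤-induction step base m n₀≤m)
  ... | inj₂ refl = base

  shift : Branch → Branch
  shift π i = π (suc i)

  prefix-length : ∀ π n → length (prefix π n) ≡ n
  prefix-length π zero = refl
  prefix-length π (suc n) = cong suc (prefix-length (shift π) n)

  prefix-∷ʳ : ∀ π n → prefix π (suc n) ≡ prefix π n ∷ʳ π n
  prefix-∷ʳ π zero = refl
  prefix-∷ʳ π (suc n) = cong (π 0 ∷_) (prefix-∷ʳ (shift π) n)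

  prefix-mono : ∀ π {m n} → m ≤ n → prefix π m ⊑ prefix π n
  prefix-mono π {zero} _ = []⊑
  prefix-mono π {suc m} {suc n} (s≤s l) = ⊑-cons (π 0) (prefix-mono (shift π) l)

  ⊑-prefix : ∀ {u} π n → u ⊑ prefix π n → u ≡ prefix π (length u)
  ⊑-prefix {[]} π n _ = refl
  ⊑-prefix {b ∷ u} π zero (_ , ())
  ⊑-prefix {b ∷ u} π (suc n) p with ⊑-uncons p
  ... | refl , p' = cong (π 0 ∷_) (⊑-prefix (shift π) n p')

  prefix-on : ∀ π n → prefix π n ∈B π
  prefix-on π n = cong (prefix π) (sym (prefix-length π n))

  on-⊑ : ∀ {x y π} → x ∈B π → y ∈B π → length x ≤ length y → x ⊑ y
  on-⊑ {x} {y} {π} ex ey l = subst₂ _⊑_ (sym ex) (sym ey) (prefix-mono π l)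

  ⊑-on : ∀ {u y π} → u ⊑ y → y ∈B π → u ∈B π
  ⊑-on {u} {y} {π} p ey = ⊑-prefix π (length y) (subst (u ⊑_) ey p)

-- Besides closure under subsets and binary unions, the main
-- result is a Ville-type criterion: the branches along which a nonnegative
-- supermartingale with initial value ≤ 1 is unbounded form a null set.
-- Its proof covers those branches by the first nodes where the scaled
-- martingale reaches 1; these nodes form an antichain, whose total mass is
-- bounded by the initial value (Kraft's inequality).
module NullSets where

  open Dyadic
  open Tree
  open import Data.Bool using (T; Bool; true; false; not; _∧_; if_then_else_)
  open import Data.List using (List; []; _∷_; _∷ʳ_; length; replicate)
  open import Data.List.Relation.Unary.All as All using (All; []; _∷_)
  open import Data.Nat as ℕ using (ℕ; zero; suc; s≤s) renaming (_≤_ to _≤ₙ_; _<_ to _<ₙ_; _+_ to _+ₙ_)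
  import Data.Nat.Properties as ℕP
  open import Data.Rational using (ℚ; 0ℚ; 1ℚ; ½; _+_; _*_; _≤_; _≤ᵇ_)
  open import Data.Rational.Properties using (≤ᵇ⇒≤; ≤⇒≤ᵇ; ≤-refl; ≤-trans; ≤-reflexive; +-mono-≤; +-identityʳ; +-identityˡ; *-identityˡ; *-distribʳ-+)
  open import Data.Product using (Σ; _×_; _,_; proj₁; proj₂)
  open import Data.Sum using (_⊎_; inj₁; inj₂)
  open import Data.Unit using (⊤; tt)
  open import Data.Empty using (⊥; ⊥-elim)
  open import Relation.Nullary using (¬_)
  open import Relation.Binary.PropositionalEquality
  open import Data.Rational.Solver
  open +-*-Solver

  Null-mono : ∀ {N M : Branch → Set} → (∀ π → N π → M π) → Null M → Null N
  Null-mono sub nullM k with nullM k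
  ... | c , covers , small = c , (λ π n → covers π (sub π n)) , small

  interleave : (ℕ → Node) → (ℕ → Node) → ℕ → Node
  interleave a b zero = a 0
  interleave a b (suc i) = interleave b (λ j → a (suc j)) i

  interleave-even-odd : ∀ i a b → interleave a b (i +ₙ i) ≡ a i × interleave a b (suc (i +ₙ i)) ≡ b i
  interleave-even-odd zero a b = refl , refl
  interleave-even-odd (suc i) a b rewrite ℕP.+-suc i i =
    proj₂ (interleave-even-odd i b (λ j → a (suc j))) , proj₂ (interleave-even-odd i (λ j → a (suc j)) (λ j → b (suc j)))

  mass : Node → ℚ
  mass v = halfPow (length v)

  partialMass-front : ∀ c n → partialMass c (suc n) ≡ mass (c 0) + partialMass (λ j → c (suc j)) n
  partialMass-front c zero = trans (+-identityˡ (mass (c 0))) (sym (+-identityʳ (mass (c 0))))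
  partialMass-front c (suc n) = trans (cong (_+ mass (c (suc n))) (partialMass-front c n))
    (solve 3 (λ a b d → (a :+ b) :+ d := a :+ (b :+ d)) refl (mass (c 0)) _ _)

  partialMass-step : ∀ c n → partialMass c n ≤ partialMass c (suc n)
  partialMass-step c n = ≤-+nonNeg (halfPow (length (c n))) (halfPow-nonNeg (length (c n)))

  -- interleaving adds masses (up to one extra term of the longer sequence)
  partialMass-interleave : ∀ n a b → partialMass (interleave a b) n ≤ partialMass a n + partialMass b n
  partialMass-interleave zero a b = ≤-reflexive refl
  partialMass-interleave (suc n) a b = ≤-trans (≤-reflexive (partialMass-front (interleave a b) n))
    (≤-trans (+-mono-≤ (≤-refl {mass (a 0)}) (partialMass-interleave n b (λ j → a (suc j))))
    (≤-trans (≤-reflexive (trans (solve 3 (λ x y z → x :+ (y :+ z) := (x :+ z) :+ y) refl (mass (a 0)) (partialMass b n) (partialMass (λ j → a (suc j)) n))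
                                  (cong (_+ partialMass b n) (sym (partialMass-front a n)))))
      (+-mono-≤ (≤-refl {partialMass a (suc n)}) (partialMass-step b n))))

  -- a union of two null sets is null: interleave covers of mass 2^-(k+1)
  Null-∪ : ∀ {N M : Branch → Set} → Null N → Null M → Null (λ π → N π ⊎ M π)
  Null-∪ nullN nullM k with nullN (suc k) | nullM (suc k)
  ... | a , coversA , smallA | b , coversB , smallB = interleave a b , covers , small
    where
    covers : ∀ π → _ → Σ ℕ λ i → interleave a b i ∈B π
    covers π (inj₁ x) with coversA π x
    ... | i , p = (i +ₙ i) , subst (_∈B π) (sym (proj₁ (interleave-even-odd i a b))) p
    covers π (inj₂ x) with coversB π x
    ... | i , p = suc (i +ₙ i) , subst (_∈B π) (sym (proj₂ (interleave-even-odd i a b))) p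
    small : ∀ n → partialMass (interleave a b) n ≤ halfPow k
    small n = ≤-trans (partialMass-interleave n a b) (≤-trans (+-mono-≤ (smallA n) (smallB n)) (≤-reflexive (halfPow-split k)))

  -- An enumeration of all nodes: binary counting with the least
  -- significant digit first, inverse to  indexOf.
  next : Node → Node
  next [] = false ∷ []
  next (false ∷ w) = true ∷ w
  next (true ∷ w) = false ∷ next w

  nodeAt : ℕ → Node
  nodeAt zero = []
  nodeAt (suc n) = next (nodeAt n)

  indexOf : Node → ℕ
  indexOf [] = 0
  indexOf (false ∷ w) = suc (indexOf w +ₙ indexOf w)
  indexOf (true ∷ w) = suc (suc (indexOf w +ₙ indexOf w))

  indexOf-next : ∀ w → indexOf (next w) ≡ suc (indexOf w)
  indexOf-next [] = refl
  indexOf-next (false ∷ w) = refl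
  indexOf-next (true ∷ w) rewrite indexOf-next w | ℕP.+-suc (indexOf w) (indexOf w) = refl

  indexOf-nodeAt : ∀ n → indexOf (nodeAt n) ≡ n
  indexOf-nodeAt zero = refl
  indexOf-nodeAt (suc n) = trans (indexOf-next (nodeAt n)) (cong suc (indexOf-nodeAt n))

  nodeAt-injective : ∀ {i j} → nodeAt i ≡ nodeAt j → i ≡ j
  nodeAt-injective {i} {j} e = trans (sym (indexOf-nodeAt i)) (trans (cong indexOf e) (indexOf-nodeAt j))

  nodeAt-even-odd : ∀ n → nodeAt (suc (n +ₙ n)) ≡ false ∷ nodeAt n × nodeAt (suc (suc (n +ₙ n))) ≡ true ∷ nodeAt n
  nodeAt-even-odd zero = refl , refl
  nodeAt-even-odd (suc n) rewrite ℕP.+-suc n n =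
    cong next (proj₂ (nodeAt-even-odd n)) , cong (λ x → next (next x)) (proj₂ (nodeAt-even-odd n))

  nodeAt-indexOf : ∀ w → nodeAt (indexOf w) ≡ w
  nodeAt-indexOf [] = refl
  nodeAt-indexOf (false ∷ w) = trans (proj₁ (nodeAt-even-odd (indexOf w))) (cong (false ∷_) (nodeAt-indexOf w))
  nodeAt-indexOf (true ∷ w) = trans (proj₂ (nodeAt-even-odd (indexOf w))) (cong (true ∷_) (nodeAt-indexOf w))

  -- f reaches 1 at v, decidably; firstHit f v: v is the first node on its
  -- path from the root where f reaches 1.
  hits : (Node → ℚ) → Node → Bool
  hits f v = 1ℚ ≤ᵇ f v

  firstHit : (Node → ℚ) → Node → Bool
  firstHit f [] = hits f []
  firstHit f (b ∷ w) = not (hits f []) ∧ firstHit (λ u → f (b ∷ u)) w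

  hits-sound : ∀ f v → hits f v ≡ true → 1ℚ ≤ f v
  hits-sound f v e = ≤ᵇ⇒≤ (subst T (sym e) tt)

  hits-complete : ∀ f v → 1ℚ ≤ f v → hits f v ≡ true
  hits-complete f v p = T⇒≡ (≤⇒≤ᵇ p)
    where
    T⇒≡ : ∀ {x} → T x → x ≡ true
    T⇒≡ {true} _ = refl

  ∧-left : ∀ {x y} → x ∧ y ≡ true → x ≡ true
  ∧-left {true} _ = refl

  ∧-right : ∀ {x y} → x ∧ y ≡ true → y ≡ true
  ∧-right {true} e = e

  firstHit-hits : ∀ f v → firstHit f v ≡ true → hits f v ≡ true
  firstHit-hits f [] e = e
  firstHit-hits f (b ∷ w) e = firstHit-hits (λ u → f (b ∷ u)) w (∧-right {not (hits f [])} e)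

  firstHit-first : ∀ f v w → firstHit f w ≡ true → v ⊑ w → v ≢ w → hits f v ≡ false
  firstHit-first f [] [] _ _ ne = ⊥-elim (ne refl)
  firstHit-first f [] (b ∷ w) e _ _ = not-true (∧-left e)
    where
    not-true : ∀ {x} → not x ≡ true → x ≡ false
    not-true {false} _ = refl
  firstHit-first f (a ∷ v) [] _ (_ , ()) _
  firstHit-first f (a ∷ v) (b ∷ w) e p ne with ⊑-uncons p
  ... | refl , p' = firstHit-first (λ u → f (a ∷ u)) v w (∧-right {not (hits f [])} e) p' (λ q → ne (cong (a ∷_) q))

  firstHit-exists : ∀ f π n → hits f (prefix π n) ≡ true → Σ ℕ λ m → firstHit f (prefix π m) ≡ true
  firstHit-exists f π zero e = 0 , e
  firstHit-exists f π (suc n) e with hits f [] in eq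
  ... | true = 0 , eq
  ... | false with firstHit-exists (λ u → f (π 0 ∷ u)) (shift π) n e
  ... | m , e' = suc m , subst (λ x → not x ∧ firstHit (λ u → f (π 0 ∷ u)) (prefix (shift π) m) ≡ true) (sym eq) e'

  Incomparable : Node → Node → Set
  Incomparable v w = ¬ (v ⊑ w) × ¬ (w ⊑ v)

  Antichain : List Node → Set
  Antichain [] = ⊤
  Antichain (v ∷ L) = All (Incomparable v) L × Antichain L

  sumMass : List Node → ℚ
  sumMass [] = 0ℚ
  sumMass (v ∷ L) = mass v + sumMass L

  NonRoot : Node → Set
  NonRoot [] = ⊥
  NonRoot (_ ∷ _) = ⊤

  root-or-nonRoot : ∀ L → Antichain L → All NonRoot L ⊎ L ≡ [] ∷ []
  root-or-nonRoot [] _ = inj₁ []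
  root-or-nonRoot ([] ∷ []) _ = inj₂ refl
  root-or-nonRoot ([] ∷ (w ∷ L)) ((i ∷ _) , _) = ⊥-elim (proj₁ i []⊑)
  root-or-nonRoot ((b ∷ v) ∷ L) (allInc , ac) with root-or-nonRoot L ac
  ... | inj₁ a = inj₁ (tt ∷ a)
  ... | inj₂ refl with allInc
  ... | i ∷ [] = ⊥-elim (proj₂ i []⊑)

  subtree : Bool → List Node → List Node
  subtree b [] = []
  subtree b ([] ∷ L) = subtree b L
  subtree false ((false ∷ w) ∷ L) = w ∷ subtree false L
  subtree false ((true ∷ w) ∷ L) = subtree false L
  subtree true ((false ∷ w) ∷ L) = subtree true L
  subtree true ((true ∷ w) ∷ L) = w ∷ subtree true L

  All-subtree : ∀ b {P Q : Node → Set} → (∀ w → P (b ∷ w) → Q w) → ∀ {L} → All P L → All Q (subtree b L)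
  All-subtree b t [] = []
  All-subtree b t {[] ∷ L} (_ ∷ a) = All-subtree b t a
  All-subtree false t {(false ∷ w) ∷ L} (p ∷ a) = t w p ∷ All-subtree false t a
  All-subtree false t {(true ∷ w) ∷ L} (p ∷ a) = All-subtree false t a
  All-subtree true t {(false ∷ w) ∷ L} (p ∷ a) = All-subtree true t a
  All-subtree true t {(true ∷ w) ∷ L} (p ∷ a) = t w p ∷ All-subtree true t a

  incomparable-tail : ∀ b w u → Incomparable (b ∷ w) (b ∷ u) → Incomparable w u
  incomparable-tail b w u (i , j) = (λ q → i (⊑-cons b q)) , (λ q → j (⊑-cons b q))

  Antichain-subtree : ∀ b L → Antichain L → Antichain (subtree b L)
  Antichain-subtree b [] _ = tt
  Antichain-subtree b ([] ∷ L) (_ , ac) = Antichain-subtree b L ac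
  Antichain-subtree false ((false ∷ w) ∷ L) (a , ac) = All-subtree false (incomparable-tail false w) a , Antichain-subtree false L ac
  Antichain-subtree false ((true ∷ w) ∷ L) (a , ac) = Antichain-subtree false L ac
  Antichain-subtree true ((false ∷ w) ∷ L) (a , ac) = Antichain-subtree true L ac
  Antichain-subtree true ((true ∷ w) ∷ L) (a , ac) = All-subtree true (incomparable-tail true w) a , Antichain-subtree true L ac

  sumMass-split : ∀ L → All NonRoot L → sumMass L ≡ ½ * sumMass (subtree false L) + ½ * sumMass (subtree true L)
  sumMass-split [] [] = sym (solve 0 (con ½ :* con 0ℚ :+ con ½ :* con 0ℚ := con 0ℚ) refl)
  sumMass-split ((false ∷ w) ∷ L) (_ ∷ a) rewrite sumMass-split L a =
    solve 3 (λ m x y → con ½ :* m :+ (con ½ :* x :+ con ½ :* y) := con ½ :* (m :+ x) :+ con ½ :* y) refl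
            (mass w) (sumMass (subtree false L)) (sumMass (subtree true L))
  sumMass-split ((true ∷ w) ∷ L) (_ ∷ a) rewrite sumMass-split L a =
    solve 3 (λ m x y → con ½ :* m :+ (con ½ :* x :+ con ½ :* y) := con ½ :* x :+ con ½ :* (m :+ y)) refl
            (mass w) (sumMass (subtree false L)) (sumMass (subtree true L))

  Supermartingale : (Node → ℚ) → Set
  Supermartingale f = (∀ v → 0ℚ ≤ f v) × (∀ v → f (v ∷ʳ false) + f (v ∷ʳ true) ≤ f v + f v)

  Supermartingale-scale : ∀ f c → 0ℚ ≤ c → Supermartingale f → Supermartingale (λ v → f v * c)
  Supermartingale-scale f c pc (fnn , fsup) = (λ v → nonNeg-* (fnn v) pc) ,
    λ v → ≤-trans (≤-reflexive (sym (*-distribʳ-+ c (f (v ∷ʳ false)) (f (v ∷ʳ true)))))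
           (≤-trans (scaleʳ c pc (fsup v)) (≤-reflexive (*-distribʳ-+ c (f v) (f v))))

  average≤ : ∀ a b c → a + b ≤ c + c → ½ * a + ½ * b ≤ c
  average≤ a b c p = ≤-trans (≤-reflexive (solve 2 (λ a b → con ½ :* a :+ con ½ :* b := con ½ :* (a :+ b)) refl a b))
    (≤-trans (scaleˡ ½ 0≤½ p) (≤-reflexive (solve 1 (λ c → con ½ :* (c :+ c) := c) refl c)))

  kraft : ∀ D f → Supermartingale f → ∀ L → All (λ v → length v ≤ₙ D) L → Antichain L →
          All (λ v → 1ℚ ≤ f v) L → sumMass L ≤ f []
  kraft D f (fnn , fsup) L lens ac hit with root-or-nonRoot L ac
  kraft D f (fnn , fsup) L lens ac (p ∷ []) | inj₂ refl = ≤-trans (≤-reflexive (+-identityʳ 1ℚ)) p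
  kraft D f (fnn , fsup) [] lens ac hit | inj₁ nr = fnn []
  kraft zero f (fnn , fsup) ((_ ∷ _) ∷ L) (() ∷ _) ac hit | inj₁ nr
  kraft zero f _ ([] ∷ L) lens ac hit | inj₁ (() ∷ _)
  kraft (suc D) f (fnn , fsup) L@(_ ∷ _) lens ac hit | inj₁ nr =
    ≤-trans (≤-reflexive (sumMass-split L nr))
      (average≤ (sumMass (subtree false L)) (sumMass (subtree true L)) (f [])
        (≤-trans (+-mono-≤ (inChild false) (inChild true)) (fsup [])))
    where
    inChild : ∀ b → sumMass (subtree b L) ≤ f (b ∷ [])
    inChild b = kraft D (λ u → f (b ∷ u)) ((λ v → fnn (b ∷ v)) , (λ v → fsup (b ∷ v))) (subtree b L)
                  (All-subtree b (λ { w (s≤s q) → q }) lens) (Antichain-subtree b L ac) (All-subtree b (λ w q → q) hit)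

  cover : (Node → ℚ) → ℕ → ℕ → Node
  cover f k i = if firstHit f (nodeAt i) then nodeAt i else replicate (i +ₙ suc (suc k)) false

  firstHits : (Node → ℚ) → ℕ → List Node
  firstHits f zero = []
  firstHits f (suc n) = if firstHit f (nodeAt n) then nodeAt n ∷ firstHits f n else firstHits f n

  padding : ℕ → ℕ → ℚ
  padding k zero = 0ℚ
  padding k (suc n) = padding k n + halfPow (n +ₙ suc (suc k))

  padding-eq : ∀ k n → padding k n + (halfPow (n +ₙ suc (suc k)) + halfPow (n +ₙ suc (suc k))) ≡ halfPow (suc k)
  padding-eq k zero = trans (+-identityˡ _) (halfPow-split (suc k))
  padding-eq k (suc n) = trans (cong (padding k n + halfPow (n +ₙ suc (suc k)) +_) (halfPow-split (n +ₙ suc (suc k))))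
    (trans (solve 2 (λ g a → g :+ a :+ a := g :+ (a :+ a)) refl (padding k n) (halfPow (n +ₙ suc (suc k)))) (padding-eq k n))

  padding≤ : ∀ k n → padding k n ≤ halfPow (suc k)
  padding≤ k n = ≤-trans (≤-+nonNeg _ (nonNeg-+ (halfPow-nonNeg (n +ₙ suc (suc k))) (halfPow-nonNeg (n +ₙ suc (suc k)))))
                         (≤-reflexive (padding-eq k n))

  length-replicate : ∀ n → length (replicate n false) ≡ n
  length-replicate zero = refl
  length-replicate (suc n) = cong suc (length-replicate n)

  partialMass-cover : ∀ f k n → partialMass (cover f k) n ≤ sumMass (firstHits f n) + padding k n
  partialMass-cover f k zero = ≤-reflexive (sym (+-identityʳ 0ℚ))
  partialMass-cover f k (suc n) with firstHit f (nodeAt n)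
  ... | true = ≤-trans (+-mono-≤ (partialMass-cover f k n) (≤-refl {mass (nodeAt n)}))
    (≤-trans (≤-reflexive (solve 3 (λ s g m → s :+ g :+ m := m :+ s :+ g) refl
                                    (sumMass (firstHits f n)) (padding k n) (mass (nodeAt n))))
      (+-mono-≤ (≤-refl {mass (nodeAt n) + sumMass (firstHits f n)})
                (≤-+nonNeg (halfPow (n +ₙ suc (suc k))) (halfPow-nonNeg (n +ₙ suc (suc k))))))
  ... | false = ≤-trans (+-mono-≤ (partialMass-cover f k n) (≤-reflexive (cong halfPow (length-replicate (n +ₙ suc (suc k))))))
    (≤-reflexive (solve 3 (λ s g m → s :+ g :+ m := s :+ (g :+ m)) refl
                          (sumMass (firstHits f n)) (padding k n) (halfPow (n +ₙ suc (suc k)))))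

  IsFirstHitBelow : (Node → ℚ) → ℕ → Node → Set
  IsFirstHitBelow f n v = Σ ℕ λ i → (i <ₙ n) × (v ≡ nodeAt i) × (firstHit f v ≡ true)

  IsFirstHitBelow-suc : ∀ {f n v} → IsFirstHitBelow f n v → IsFirstHitBelow f (suc n) v
  IsFirstHitBelow-suc (i , l , e , m) = i , ℕP.m≤n⇒m≤1+n l , e , m

  firstHits-members : ∀ f n → All (IsFirstHitBelow f n) (firstHits f n)
  firstHits-members f zero = []
  firstHits-members f (suc n) with firstHit f (nodeAt n) in eq
  ... | true = (n , ℕP.≤-refl , refl , eq) ∷ All.map IsFirstHitBelow-suc (firstHits-members f n)
  ... | false = All.map IsFirstHitBelow-suc (firstHits-members f n)

  firstHits-antichain : ∀ f n → Antichain (firstHits f n)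
  firstHits-antichain f zero = tt
  firstHits-antichain f (suc n) with firstHit f (nodeAt n) in eq
  ... | true = All.map incomparable (firstHits-members f n) , firstHits-antichain f n
    where
    true≢false : true ≢ false
    true≢false ()
    incomparable : ∀ {v} → IsFirstHitBelow f n v → Incomparable (nodeAt n) v
    incomparable {v} (i , l , refl , m) =
      (λ p → true≢false (trans (sym (firstHit-hits f (nodeAt n) eq))
                 (firstHit-first f (nodeAt n) (nodeAt i) m p (λ e → ℕP.<-irrefl (sym (nodeAt-injective e)) l)))) ,
      (λ p → true≢false (trans (sym (firstHit-hits f (nodeAt i) m))
                 (firstHit-first f (nodeAt i) (nodeAt n) eq p (λ e → ℕP.<-irrefl (nodeAt-injective e) l))))
  ... | false = firstHits-antichain f n

  maxLength : List Node → ℕ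
  maxLength [] = 0
  maxLength (v ∷ L) = length v ℕ.⊔ maxLength L

  maxLength-bounds : ∀ L → All (λ v → length v ≤ₙ maxLength L) L
  maxLength-bounds [] = []
  maxLength-bounds (v ∷ L) = ℕP.m≤m⊔n (length v) (maxLength L) ∷
    All.map (λ q → ℕP.≤-trans q (ℕP.m≤n⊔m (length v) (maxLength L))) (maxLength-bounds L)

  nullBySupermartingales : ∀ {N : Branch → Set} →
    ((k : ℕ) → Σ (Node → ℚ) λ f → Supermartingale f × (f [] ≤ halfPow (suc k))
                                  × (∀ π → N π → Σ ℕ λ n → 1ℚ ≤ f (prefix π n))) →
    Null N
  nullBySupermartingales {N} martingales k with martingales k
  ... | f , sup , root , reaches = cover f k , covers , small
    where
    covers : ∀ π → N π → Σ ℕ λ i → cover f k i ∈B π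
    covers π x with reaches π x
    ... | n , p with firstHit-exists f π n (hits-complete f (prefix π n) p)
    ... | m , first = indexOf (prefix π m) , subst (_∈B π) (sym coverAt) (prefix-on π m)
      where
      first' : firstHit f (nodeAt (indexOf (prefix π m))) ≡ true
      first' = subst (λ v → firstHit f v ≡ true) (sym (nodeAt-indexOf (prefix π m))) first
      coverAt : cover f k (indexOf (prefix π m)) ≡ prefix π m
      coverAt rewrite first' = nodeAt-indexOf (prefix π m)
    small : ∀ n → partialMass (cover f k) n ≤ halfPow k
    small n = ≤-trans (partialMass-cover f k n)
      (≤-trans (+-mono-≤ (≤-trans (kraft (maxLength (firstHits f n)) f sup (firstHits f n)
                                     (maxLength-bounds (firstHits f n)) (firstHits-antichain f n)
                                     (All.map (λ { (i , l , e , m) → hits-sound f _ (firstHit-hits f _ m) }) (firstHits-members f n)))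
                                  root)
                          (padding≤ k n))
        (≤-reflexive (halfPow-split k)))

  UnboundedOn : (Node → ℚ) → Branch → Set
  UnboundedOn V π = (k : ℕ) → Σ ℕ λ n → twoPow k ≤ V (prefix π n)

  ville : ∀ {N : Branch → Set} V → Supermartingale V → V [] ≤ 1ℚ → (∀ π → N π → UnboundedOn V π) → Null N
  ville V sup root unbounded = nullBySupermartingales λ k →
    (λ v → V v * halfPow (suc k)) ,
    Supermartingale-scale V (halfPow (suc k)) (halfPow-nonNeg (suc k)) sup ,
    ≤-trans (scaleʳ (halfPow (suc k)) (halfPow-nonNeg (suc k)) root) (≤-reflexive (*-identityˡ (halfPow (suc k)))) ,
    λ π x → let (n , large) = unbounded π x (suc k) in
      n , ≤-trans (≤-reflexive (sym (twoPow*halfPow (suc k)))) (scaleʳ (halfPow (suc k)) (halfPow-nonNeg (suc k)) large)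

-- Given start nodes x with chosen targets tgt x below
-- them, the machine walks down the tree carrying a capital B and a count c of
-- won bets.  Idle, it becomes active upon reaching a start node x: it then
-- bets that the walk follows the path to tgt x.  Reaching tgt x the capital
-- is multiplied by onWin x (and c increases); leaving the path it is
-- multiplied by onLoss x and the machine behaves as if it had just arrived.
-- The value of an active state at v is the expected capital at the end of the
-- bet; under the fairness hypothesis  fair  it is a supermartingale.
module Betting where

  open Dyadic
  open Tree
  open import Data.Bool using (Bool; true; false; if_then_else_)
  open import Data.Rational using (ℚ; 0ℚ; 1ℚ; ½; _+_; _*_; _-_; _≤_)
  open import Data.Rational.Properties using (≤-refl; ≤-trans; ≤-reflexive; +-mono-≤; +-comm; *-identityʳ)
  open import Data.List using ([]; _∷_; _++_; _∷ʳ_; length)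
  open import Data.List.Properties using (++-assoc; ++-identityʳ)
  open import Data.Nat as ℕ using (ℕ; zero; suc; z≤n; s≤s; _∸_) renaming (_≤_ to _≤ₙ_; _<_ to _<ₙ_; _+_ to _+ₙ_)
  import Data.Nat.Properties as ℕP
  open import Data.Product using (Σ; _×_; _,_; proj₁; proj₂)
  open import Data.Empty using (⊥-elim)
  open import Relation.Nullary using (¬_; Dec; yes; no)
  open import Relation.Binary.PropositionalEquality
  open import Data.Rational.Solver
  open +-*-Solver

  module Machine (start : Node → Bool) (tgt : Node → Node) (onLoss onWin : Node → ℚ)
    (start-interval : ∀ x → start x ≡ true → x ⊑ tgt x × length x <ₙ length (tgt x))
    (onLoss-nonNeg : ∀ x → start x ≡ true → 0ℚ ≤ onLoss x)
    (onWin-nonNeg : ∀ x → start x ≡ true → 0ℚ ≤ onWin x)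
    (fair : ∀ x → start x ≡ true →
       (1ℚ - halfPow (length (tgt x) ∸ length x)) * onLoss x + halfPow (length (tgt x) ∸ length x) * onWin x ≤ 1ℚ)
    where

    data State : Set where
      idle : ℚ → ℕ → State
      active : ℚ → ℕ → Node → State

    capital : State → ℚ
    capital (idle B c) = B
    capital (active B c x) = B

    completions : State → ℕ
    completions (idle B c) = c
    completions (active B c x) = c

    enter : Node → ℚ → ℕ → State
    enter u B c = if start u then active B c u else idle B c

    stepActive : ∀ v b B c x → Dec ((v ∷ʳ b) ⊑ tgt x) → Dec (length (v ∷ʳ b) ≡ length (tgt x)) → State
    stepActive v b B c x (yes _) (yes _) = idle (B * onWin x) (suc c)
    stepActive v b B c x (yes _) (no _) = active B c x
    stepActive v b B c x (no _) _ = enter (v ∷ʳ b) (B * onLoss x) c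

    step : Node → Bool → State → State
    step v b (idle B c) = enter (v ∷ʳ b) B c
    step v b (active B c x) = stepActive v b B c x ((v ∷ʳ b) ⊑? tgt x) (length (v ∷ʳ b) ℕ.≟ length (tgt x))

    initial : State
    initial = enter [] 1ℚ 0

    run : Node → State → Node → State
    run p s [] = s
    run p s (b ∷ w) = run (p ∷ʳ b) (step p b s) w

    stateAt : Node → State
    stateAt v = run [] initial v

    -- the probability that a branch through v reaches tgt x, for v ⊑ tgt x
    winProb : Node → Node → ℚ
    winProb v x = halfPow (length (tgt x) ∸ length v)

    expected : ℚ → Node → ℚ → ℚ
    expected B x p = B * ((1ℚ - p) * onLoss x + p * onWin x)

    value : Node → State → ℚ
    value v (idle B c) = B
    value v (active B c x) = expected B x (winProb v x)

    data StepCase (v : Node) (b : Bool) (B : ℚ) (c : ℕ) (x : Node) (s : State) : Set where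
      won : (v ∷ʳ b) ≡ tgt x → s ≡ idle (B * onWin x) (suc c) → StepCase v b B c x s
      onPath : (v ∷ʳ b) ⊑ tgt x → length (v ∷ʳ b) <ₙ length (tgt x) → s ≡ active B c x → StepCase v b B c x s
      lost : ¬ ((v ∷ʳ b) ⊑ tgt x) → s ≡ enter (v ∷ʳ b) (B * onLoss x) c → StepCase v b B c x s

    step-cases : ∀ v b B c x → StepCase v b B c x (step v b (active B c x))
    step-cases v b B c x = classify ((v ∷ʳ b) ⊑? tgt x) (length (v ∷ʳ b) ℕ.≟ length (tgt x))
      where
      classify : ∀ d e → StepCase v b B c x (stepActive v b B c x d e)
      classify (yes q) (yes e) = won (⊑-length-≡ q (ℕP.≤-reflexive (sym e))) refl
      classify (yes q) (no ne) = onPath q (ℕP.≤∧≢⇒< (⊑-length q) ne) refl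
      classify (no nq) _ = lost nq refl

    step-elim : (P : State → Set) → ∀ v b B c x →
      ((v ∷ʳ b) ≡ tgt x → P (idle (B * onWin x) (suc c))) →
      ((v ∷ʳ b) ⊑ tgt x → length (v ∷ʳ b) <ₙ length (tgt x) → P (active B c x)) →
      (¬ ((v ∷ʳ b) ⊑ tgt x) → P (enter (v ∷ʳ b) (B * onLoss x) c)) →
      P (step v b (active B c x))
    step-elim P v b B c x onWon onPath' onLost with step-cases v b B c x
    ... | won e E = subst P (sym E) (onWon e)
    ... | onPath q lt E = subst P (sym E) (onPath' q lt)
    ... | lost nq E = subst P (sym E) (onLost nq)

    enter-elim : (P : State → Set) → ∀ u B c → (start u ≡ true → P (active B c u)) → P (idle B c) → P (enter u B c)
    enter-elim P u B c onStart onIdle with start u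
    ... | true = onStart refl
    ... | false = onIdle

    enter-start : ∀ u B c → start u ≡ true → enter u B c ≡ active B c u
    enter-start u B c e rewrite e = refl

    capital-enter : ∀ u B c → capital (enter u B c) ≡ B
    capital-enter u B c with start u
    ... | true = refl
    ... | false = refl

    completions-enter : ∀ u B c → completions (enter u B c) ≡ c
    completions-enter u B c with start u
    ... | true = refl
    ... | false = refl

    run-∷ʳ : ∀ w p s b → run p s (w ∷ʳ b) ≡ step (p ++ w) b (run p s w)
    run-∷ʳ [] p s b = cong (λ q → step q b s) (sym (++-identityʳ p))
    run-∷ʳ (c ∷ w) p s b = trans (run-∷ʳ w (p ∷ʳ c) (step p c s) b)
      (cong (λ q → step q b (run (p ∷ʳ c) (step p c s) w)) (++-assoc p (c ∷ []) w))

    stateAt-∷ʳ : ∀ v b → stateAt (v ∷ʳ b) ≡ step v b (stateAt v)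
    stateAt-∷ʳ v b = run-∷ʳ v [] initial b

    stateAt-suc : ∀ π n → stateAt (prefix π (suc n)) ≡ step (prefix π n) (π n) (stateAt (prefix π n))
    stateAt-suc π n = trans (cong stateAt (prefix-∷ʳ π n)) (stateAt-∷ʳ (prefix π n) (π n))

    run-invariant : (P : Node → State → Set) → (∀ p b s → P p s → P (p ∷ʳ b) (step p b s)) →
      ∀ w p s → P p s → P (p ++ w) (run p s w)
    run-invariant P t [] p s x = subst (λ q → P q s) (sym (++-identityʳ p)) x
    run-invariant P t (b ∷ w) p s x = subst (λ q → P q (run (p ∷ʳ b) (step p b s) w)) (++-assoc p (b ∷ []) w)
      (run-invariant P t w (p ∷ʳ b) (step p b s) (t p b s x))

    stateAt-invariant : (P : Node → State → Set) → (∀ p b s → P p s → P (p ∷ʳ b) (step p b s)) →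
      P [] initial → ∀ v → P v (stateAt v)
    stateAt-invariant P t x v = run-invariant P t v [] initial x

    WellFormed : Node → State → Set
    WellFormed v (idle B c) = 0ℚ ≤ B
    WellFormed v (active B c x) = 0ℚ ≤ B × start x ≡ true × x ⊑ v × v ⊑ tgt x × length v <ₙ length (tgt x)

    wellFormed-enter : ∀ u B c → 0ℚ ≤ B → WellFormed u (enter u B c)
    wellFormed-enter u B c p with start u in e
    ... | true = p , e , ⊑-refl u , proj₁ (start-interval u e) , proj₂ (start-interval u e)
    ... | false = p

    wellFormed-step : ∀ v b s → WellFormed v s → WellFormed (v ∷ʳ b) (step v b s)
    wellFormed-step v b (idle B c) p = wellFormed-enter (v ∷ʳ b) B c p
    wellFormed-step v b (active B c x) (p , sx , xv , vy , l) with step-cases v b B c x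
    ... | won _ E rewrite E = nonNeg-* p (onWin-nonNeg x sx)
    ... | onPath q lt E rewrite E = p , sx , ⊑-trans xv (⊑-++ v (b ∷ [])) , q , lt
    ... | lost _ E rewrite E = wellFormed-enter (v ∷ʳ b) (B * onLoss x) c (nonNeg-* p (onLoss-nonNeg x sx))

    wellFormed : ∀ v → WellFormed v (stateAt v)
    wellFormed = stateAt-invariant WellFormed wellFormed-step (wellFormed-enter [] 1ℚ 0 0≤1)

    value-nonNeg′ : ∀ v s → WellFormed v s → 0ℚ ≤ value v s
    value-nonNeg′ v (idle B c) p = p
    value-nonNeg′ v (active B c x) (p , sx , _) = nonNeg-* p
      (nonNeg-+ (nonNeg-* (nonNeg-∸ (halfPow≤1 (length (tgt x) ∸ length v))) (onLoss-nonNeg x sx))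
                (nonNeg-* (halfPow-nonNeg (length (tgt x) ∸ length v)) (onWin-nonNeg x sx)))

    -- placing a bet does not increase the value: this is where  fair  is used
    value-enter : ∀ u B c → 0ℚ ≤ B → value u (enter u B c) ≤ B
    value-enter u B c p with start u in e
    ... | true = ≤-trans (scaleˡ B p (fair u e)) (≤-reflexive (*-identityʳ B))
    ... | false = ≤-refl

    value-onPath : ∀ v b B c x → (v ∷ʳ b) ⊑ tgt x →
      value (v ∷ʳ b) (step v b (active B c x)) + B * onLoss x ≡ value v (active B c x) + value v (active B c x)
    value-onPath v b B c x q with step-cases v b B c x
    ... | won e E rewrite E = trans
          (solve 3 (λ B α β → B :* β :+ B :* α :=
                      B :* ((con 1ℚ :- con ½ :* con 1ℚ) :* α :+ (con ½ :* con 1ℚ) :* β)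
                      :+ B :* ((con 1ℚ :- con ½ :* con 1ℚ) :* α :+ (con ½ :* con 1ℚ) :* β)) refl B (onLoss x) (onWin x))
          (cong (λ p → expected B x p + expected B x p) (sym (cong halfPow gap)))
      where
      gap : length (tgt x) ∸ length v ≡ 1
      gap = trans (cong (λ y → length y ∸ length v) (sym e))
                  (trans (cong (_∸ length v) (length-∷ʳ v b)) (ℕP.m+n∸n≡m 1 (length v)))
    ... | onPath _ lt E rewrite E = trans
          (solve 4 (λ B α β t → B :* ((con 1ℚ :- t) :* α :+ t :* β) :+ B :* α :=
                      B :* ((con 1ℚ :- con ½ :* t) :* α :+ (con ½ :* t) :* β)
                      :+ B :* ((con 1ℚ :- con ½ :* t) :* α :+ (con ½ :* t) :* β)) refl B (onLoss x) (onWin x) (winProb (v ∷ʳ b) x))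
          (cong (λ p → expected B x p + expected B x p) (sym (cong halfPow gap)))
      where
      gap : length (tgt x) ∸ length v ≡ suc (length (tgt x) ∸ length (v ∷ʳ b))
      gap = trans (ℕP.+-∸-assoc 1 (ℕP.<⇒≤ (subst (_<ₙ length (tgt x)) (length-∷ʳ v b) lt)))
                  (cong (λ m → suc (length (tgt x) ∸ m)) (sym (length-∷ʳ v b)))
    ... | lost nq _ = ⊥-elim (nq q)

    value-offPath : ∀ v b B c x → 0ℚ ≤ B → start x ≡ true → ¬ ((v ∷ʳ b) ⊑ tgt x) →
      value (v ∷ʳ b) (step v b (active B c x)) ≤ B * onLoss x
    value-offPath v b B c x p sx nq with step-cases v b B c x
    ... | won e _ = ⊥-elim (nq (subst ((v ∷ʳ b) ⊑_) e (⊑-refl (v ∷ʳ b))))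
    ... | onPath q _ _ = ⊥-elim (nq q)
    ... | lost _ E rewrite E = value-enter (v ∷ʳ b) (B * onLoss x) c (nonNeg-* p (onLoss-nonNeg x sx))

    value-step : ∀ v s → WellFormed v s →
      value (v ∷ʳ false) (step v false s) + value (v ∷ʳ true) (step v true s) ≤ value v s + value v s
    value-step v (idle B c) p = +-mono-≤ (value-enter (v ∷ʳ false) B c p) (value-enter (v ∷ʳ true) B c p)
    value-step v (active B c x) (p , sx , xv , vy , l) with childTowards vy l
    ... | false , on , off = ≤-trans (+-mono-≤ (≤-refl {value (v ∷ʳ false) (step v false (active B c x))})
                                               (value-offPath v true B c x p sx off))
                                     (≤-reflexive (value-onPath v false B c x on))
    ... | true , on , off = ≤-trans (+-mono-≤ (value-offPath v false B c x p sx off)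
                                              (≤-refl {value (v ∷ʳ true) (step v true (active B c x))}))
                                    (≤-reflexive (trans (+-comm (B * onLoss x) _) (value-onPath v true B c x on)))

    value-super : ∀ v → value (v ∷ʳ false) (stateAt (v ∷ʳ false)) + value (v ∷ʳ true) (stateAt (v ∷ʳ true))
                        ≤ value v (stateAt v) + value v (stateAt v)
    value-super v rewrite stateAt-∷ʳ v false | stateAt-∷ʳ v true = value-step v (stateAt v) (wellFormed v)

    value-nonNeg : ∀ v → 0ℚ ≤ value v (stateAt v)
    value-nonNeg v = value-nonNeg′ v (stateAt v) (wellFormed v)

    value-root : value [] (stateAt []) ≤ 1ℚ
    value-root = value-enter [] 1ℚ 0 0≤1

    NonNested : Set
    NonNested = ∀ x u → start x ≡ true → start u ≡ true → x ⊑ u → u ⊑ tgt x → x ≡ u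

    step-enters : NonNested → ∀ v b s → WellFormed v s → start (v ∷ʳ b) ≡ true →
      Σ ℚ λ B → Σ ℕ λ c → step v b s ≡ active B c (v ∷ʳ b)
    step-enters nonNested v b (idle B c) _ e = B , c , enter-start (v ∷ʳ b) B c e
    step-enters nonNested v b (active B c x) (p , sx , xv , vy , l) e =
      step-elim (λ s → Σ ℚ λ B' → Σ ℕ λ c' → s ≡ active B' c' (v ∷ʳ b)) v b B c x
        (λ eq → ⊥-elim (not-inside (subst ((v ∷ʳ b) ⊑_) eq (⊑-refl (v ∷ʳ b)))))
        (λ q _ → ⊥-elim (not-inside q))
        (λ _ → B * onLoss x , c , enter-start (v ∷ʳ b) (B * onLoss x) c e)
      where
      not-inside : ¬ ((v ∷ʳ b) ⊑ tgt x)
      not-inside q = ℕP.<-irrefl refl (ℕP.≤-trans (ℕP.≤-reflexive (sym (length-∷ʳ v b)))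
        (⊑-length (subst (_⊑ v) (nonNested x (v ∷ʳ b) sx e (⊑-trans xv (⊑-++ v (b ∷ []))) q) xv)))

    active-at-start : NonNested → ∀ π n → start (prefix π n) ≡ true →
      Σ ℚ λ B → Σ ℕ λ c → stateAt (prefix π n) ≡ active B c (prefix π n)
    active-at-start nonNested π zero e = 1ℚ , 0 , enter-start [] 1ℚ 0 e
    active-at-start nonNested π (suc n) e
      with step-enters nonNested (prefix π n) (π n) (stateAt (prefix π n)) (wellFormed (prefix π n))
                       (subst (λ u → start u ≡ true) (prefix-∷ʳ π n) e)
    ... | B , c , E = B , c , trans (stateAt-suc π n) (trans E (cong (active B c) (sym (prefix-∷ʳ π n))))

    length-prefix-∷ʳ : ∀ π n → length (prefix π n ∷ʳ π n) ≡ suc n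
    length-prefix-∷ʳ π n = trans (cong length (sym (prefix-∷ʳ π n))) (prefix-length π (suc n))

    won-after : ∀ π x B c d n → suc (n +ₙ d) ≡ length (tgt x) → tgt x ∈B π → stateAt (prefix π n) ≡ active B c x →
      stateAt (prefix π (suc (n +ₙ d))) ≡ idle (B * onWin x) (suc c)
    won-after π x B c d n E tπ S with step-cases (prefix π n) (π n) B c x
    ... | lost off _ = ⊥-elim (off (subst (_⊑ tgt x) (prefix-∷ʳ π n)
            (on-⊑ (prefix-on π (suc n)) tπ (ℕP.≤-trans (ℕP.≤-reflexive (prefix-length π (suc n)))
                                              (ℕP.≤-trans (s≤s (ℕP.m≤m+n n d)) (ℕP.≤-reflexive E))))))
    won-after π x B c zero n E tπ S | won _ W rewrite ℕP.+-identityʳ n =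
      trans (stateAt-suc π n) (trans (cong (step (prefix π n) (π n)) S) W)
    won-after π x B c (suc d) n E tπ S | won e _ =
      ⊥-elim (ℕP.<-irrefl (sym (ℕP.suc-injective (trans E (trans (cong length (sym e)) (length-prefix-∷ʳ π n)))))
                          (ℕP.m<m+n n (s≤s z≤n)))
    won-after π x B c zero n E tπ S | onPath _ lt _ =
      ⊥-elim (ℕP.<-irrefl (trans (length-prefix-∷ʳ π n) (trans (cong suc (sym (ℕP.+-identityʳ n))) E)) lt)
    won-after π x B c (suc d) n E tπ S | onPath _ _ P =
      subst (λ m → stateAt (prefix π m) ≡ idle (B * onWin x) (suc c)) (cong suc (sym (ℕP.+-suc n d)))
        (won-after π x B c d (suc n) (trans (cong suc (sym (ℕP.+-suc n d))) E) tπ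
           (trans (stateAt-suc π n) (trans (cong (step (prefix π n) (π n)) S) P)))

    won-at-target : ∀ π n x B c → stateAt (prefix π n) ≡ active B c x → tgt x ∈B π →
      stateAt (tgt x) ≡ idle (B * onWin x) (suc c)
    won-at-target π n x B c S tπ =
      subst (λ u → stateAt u ≡ idle (B * onWin x) (suc c)) (trans (cong (prefix π) E) (sym tπ))
        (won-after π x B c (length (tgt x) ∸ suc n) n E tπ S)
      where
      lt : n <ₙ length (tgt x)
      lt = subst (_<ₙ length (tgt x)) (prefix-length π n)
             (proj₂ (proj₂ (proj₂ (proj₂ (subst (WellFormed (prefix π n)) S (wellFormed (prefix π n)))))))
      E : suc (n +ₙ (length (tgt x) ∸ suc n)) ≡ length (tgt x)
      E = ℕP.m+[n∸m]≡n lt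

    completions-step : ∀ v b s → completions s ≤ₙ completions (step v b s)
    completions-step v b (idle B c) = ℕP.≤-reflexive (sym (completions-enter (v ∷ʳ b) B c))
    completions-step v b (active B c x) with step-cases v b B c x
    ... | won _ E rewrite E = ℕP.n≤1+n c
    ... | onPath _ _ E rewrite E = ℕP.≤-refl
    ... | lost _ E rewrite E = ℕP.≤-reflexive (sym (completions-enter (v ∷ʳ b) (B * onLoss x) c))

    completions-mono : ∀ π n m → n ≤ₙ m → completions (stateAt (prefix π n)) ≤ₙ completions (stateAt (prefix π m))
    completions-mono π n = ≤-induction {P = λ m → completions (stateAt (prefix π n)) ≤ₙ completions (stateAt (prefix π m))}
      (λ m _ c≤ → ℕP.≤-trans c≤ (subst (λ s → completions (stateAt (prefix π m)) ≤ₙ completions s) (sym (stateAt-suc π m))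
                                        (completions-step (prefix π m) (π m) (stateAt (prefix π m)))))
      ℕP.≤-refl

module Decisions (em : ExcludedMiddle (lsuc 0ℓ)) where

  open import Data.Bool using (true; false)
  open import Data.Product using (Σ; _,_)
  open import Data.Empty using (⊥-elim)
  open import Level using (Lift; lift)
  open import Relation.Nullary using (¬_; Dec; yes; no)
  open import Relation.Nullary.Decidable using (isYes; decidable-stable)
  open import Relation.Binary.PropositionalEquality using (_≡_; refl)

  decide : (P : Set) → Dec P
  decide P with em {Lift (lsuc 0ℓ) P}
  ... | yes (lift p) = yes p
  ... | no np = no (λ p → np (lift p))

  decide₁ : (P : Set₁) → Dec P
  decide₁ P = em

  ¬∀⇒∃¬ : {A : Set} {P : A → Set} → ¬ (∀ a → P a) → Σ A λ a → ¬ P a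
  ¬∀⇒∃¬ {A} {P} n with decide (Σ A λ a → ¬ P a)
  ... | yes e = e
  ... | no ne = ⊥-elim (n (λ a → decidable-stable (decide (P a)) (λ np → ne (a , np))))

  isYes-true : ∀ {P : Set} (d : Dec P) → isYes d ≡ true → P
  isYes-true (yes p) _ = p

  isYes-false : ∀ {P : Set} (d : Dec P) → isYes d ≡ false → ¬ P
  isYes-false (no np) _ = np

  isYes-complete : ∀ {P : Set} (d : Dec P) → P → isYes d ≡ true
  isYes-complete (yes p) _ = refl
  isYes-complete (no np) p = ⊥-elim (np p)

module Families (em : ExcludedMiddle (lsuc 0ℓ)) (I : Node → Node → Set) (IF : IntervalFamily I) where

  open Tree
  open Decisions em
  open import Data.List using ([]; length)
  open import Data.Nat as ℕ using (ℕ; zero; suc; s≤s) renaming (_≤_ to _≤ₙ_; _<_ to _<ₙ_)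
  import Data.Nat.Properties as ℕP
  open import Data.Product using (Σ; _×_; _,_; proj₁; proj₂)
  open import Data.Sum using (inj₁; inj₂)
  open import Data.Empty using (⊥-elim)
  open import Relation.Nullary using (¬_; yes; no)
  open import Relation.Binary.PropositionalEquality

  interval-strict : ∀ {x y} → I x y → x ⊑ y × length x <ₙ length y
  interval-strict {x} {y} i with proj₁ IF x y i
  ... | le , ne = le , ℕP.≤∧≢⇒< (⊑-length le) (λ e → ne (⊑-length-≡ le (ℕP.≤-reflexive (sym e))))

  target-unique : ∀ {x y y'} → I x y → I x y' → y ≡ y'
  target-unique {x} {y} {y'} i i' with proj₂ IF x y x y' i i'
  ... | inj₁ (_ , e) = e
  ... | inj₂ n = ⊥-elim (n (x , (⊑-refl x , proj₁ (interval-strict i)) , (⊑-refl x , proj₁ (interval-strict i'))))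

  nested-equal : ∀ {x y u t} → I x y → I u t → x ⊑ u → u ⊑ y → x ≡ u
  nested-equal {x} {y} {u} {t} i i' xu uy with proj₂ IF x y u t i i'
  ... | inj₁ (e , _) = e
  ... | inj₂ n = ⊥-elim (n (u , (xu , uy) , (⊑-refl u , proj₁ (interval-strict i'))))

  -- the target of a source (chosen classically; [] elsewhere)
  tgt : Node → Node
  tgt x with decide (source I x)
  ... | yes (y , _) = y
  ... | no _ = []

  tgt-interval : ∀ {x} → source I x → I x (tgt x)
  tgt-interval {x} s with decide (source I x)
  ... | yes (y , i) = i
  ... | no ns = ⊥-elim (ns s)

  tgt-unique : ∀ {x y} → I x y → tgt x ≡ y
  tgt-unique {x} {y} i = target-unique (tgt-interval (y , i)) i

  StrictPrefix : Node → Node → Set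
  StrictPrefix a b = a ⊑ b × ¬ (b ⊑ a)

  -- y is a target strictly below x with no source strictly in between: the
  -- first-order description of "[x,y] ∈ 𝓘" used in the formula
  Partner : Node → Node → Set
  Partner x y = target I y × StrictPrefix x y × ¬ (Σ Node λ z → source I z × StrictPrefix x z × StrictPrefix z y)

  interval-strictPrefix : ∀ {x y} → I x y → StrictPrefix x y
  interval-strictPrefix i = proj₁ (interval-strict i) , λ yx → ℕP.<-irrefl refl (ℕP.≤-trans (proj₂ (interval-strict i)) (⊑-length yx))

  interval⇒partner : ∀ {x y} → I x y → Partner x y
  interval⇒partner {x} {y} i = (x , i) , interval-strictPrefix i , λ { (z , (t , it) , xz , zy) →
     proj₂ xz (subst (_⊑ x) (nested-equal i it (proj₁ xz) (proj₁ zy)) (⊑-refl x)) }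

  partner⇒interval : ∀ {x y} → source I x → Partner x y → I x y
  partner⇒interval {x} {y} (t , ixt) ((x' , ix'y) , xy , nz) with ⊑-comparable (proj₁ xy) (proj₁ (interval-strict ix'y))
  ... | inj₁ xx' with decide (x' ⊑ x)
  ...   | yes x'x = subst (λ q → I q y) (⊑-antisym x'x xx') ix'y
  ...   | no nx'x = ⊥-elim (nz (x' , (y , ix'y) , (xx' , nx'x) , interval-strictPrefix ix'y))
  partner⇒interval {x} {y} (t , ixt) ((x' , ix'y) , xy , nz) | inj₂ x'x with proj₂ IF x' y x t ix'y ixt
  ... | inj₁ (e , _) = subst (λ q → I q y) e ix'y
  ... | inj₂ n = ⊥-elim (n (x , (x'x , proj₁ xy) , (⊑-refl x , proj₁ (interval-strict ixt))))

  bounded-lengths : ∀ {π} → ¬ LimsupInfinite I π → Σ ℕ λ L → ∀ x y → I x y → x ∈B π → intervalLength x y <ₙ L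
  bounded-lengths {π} nls with ¬∀⇒∃¬ nls
  ... | L , nL = L , λ x y i xπ → ℕP.≰⇒> (λ le → nL (x , y , i , xπ , le))

  shallow-bound : ∀ π d → Σ ℕ λ B0 → ∀ x y → I x y → x ∈B π → length x <ₙ d → intervalLength x y ≤ₙ B0
  shallow-bound π zero = 0 , λ x y i xπ ()
  shallow-bound π (suc d) with shallow-bound π d | decide (source I (prefix π d))
  ... | B0 , f | yes (y0 , i0) = B0 ℕ.⊔ intervalLength (prefix π d) y0 , g
    where
    g : ∀ x y → I x y → x ∈B π → length x <ₙ suc d → intervalLength x y ≤ₙ B0 ℕ.⊔ intervalLength (prefix π d) y0
    g x y i xπ (s≤s l) with ℕP.m≤n⇒m<n∨m≡n l
    ... | inj₁ lt = ℕP.≤-trans (f x y i xπ lt) (ℕP.m≤m⊔n B0 _)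
    ... | inj₂ refl = ℕP.≤-trans (ℕP.≤-reflexive (cong₂ intervalLength xπ (target-unique i (subst (λ q → I q y0) (sym xπ) i0))))
                        (ℕP.m≤n⊔m B0 _)
  ... | B0 , f | no ns = B0 , g
    where
    g : ∀ x y → I x y → x ∈B π → length x <ₙ suc d → intervalLength x y ≤ₙ B0
    g x y i xπ (s≤s l) with ℕP.m≤n⇒m<n∨m≡n l
    ... | inj₁ lt = f x y i xπ lt
    ... | inj₂ refl = ⊥-elim (ns (y , subst (λ q → I q y) xπ i))

  HitsInfinitely : (Node → Set) → Branch → Set
  HitsInfinitely W π = ∀ u → u ∈B π → Σ Node λ x → x ∈B π × u ⊑ x × (W x × source I x)

  FinitelyCompleted : (Node → Set) → Branch → Set
  FinitelyCompleted W π = Σ Node λ u → u ∈B π ×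
    (∀ x → x ∈B π → u ⊑ x → (W x × source I x) → ∀ y → y ∈B π → ¬ I x y)

-- Scanning a branch from the root, a source x is greedy
-- when its interval is longer than 1 + (the number of greedy nodes strictly
-- above x).  Two facts about G are needed:
--   limsup⇒hits : if limsup 𝓘(π) = ∞ then π meets G infinitely often;
--   greedy-finitelyCompleted : almost surely only finitely many greedy
--     intervals are completed along π.
-- For the second, bet on every greedy interval [x, tgt x]: a branch through
-- x follows it with probability p = 2^-(ℓ+1), ℓ its length; the capital
-- doubles if it does and is multiplied by 1 - 2p otherwise.  If x is the
-- (j+1)-st greedy node of its branch then ℓ ≥ j + 2, so a lost bet costs at
-- most the factor 1 - 2^-(j+2); a reserve ½ + 2^-(j+1) absorbs all these
-- losses, so after c won bets the capital is still ≥ 2^c / 2.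
module Greedy (em : ExcludedMiddle (lsuc 0ℓ)) (I : Node → Node → Set) (IF : IntervalFamily I) where

  open Dyadic
  open Tree
  open NullSets using (UnboundedOn; ville)
  open Decisions em
  open Families em I IF
  open import Data.Bool using (Bool; true; false)
  open import Data.List using ([]; _∷_; _++_; _∷ʳ_; length)
  open import Data.List.Properties using (++-assoc; ++-identityʳ)
  open import Data.Nat as ℕ using (ℕ; zero; suc; z≤n; s≤s; _∸_) renaming (_≤_ to _≤ₙ_; _<_ to _<ₙ_; _+_ to _+ₙ_)
  import Data.Nat.Properties as ℕP
  open import Data.Rational using (ℚ; 0ℚ; 1ℚ; ½; _+_; _*_; _-_; _≤_)
  open import Data.Rational.Properties using (≤-refl; ≤-trans; ≤-reflexive; +-mono-≤; *-comm; *-assoc; *-identityˡ; module ≤-Reasoning)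
  open import Data.Product using (Σ; _×_; _,_; proj₁; proj₂)
  open import Data.Empty using (⊥-elim)
  open import Relation.Nullary using (¬_; Dec; yes; no)
  open import Relation.Nullary.Decidable using (isYes)
  open import Relation.Binary.PropositionalEquality
  open import Data.Rational.Solver
  open +-*-Solver

  LongerThan : Node → ℕ → Set
  LongerThan p k = Σ Node λ y → I p y × suc (suc k) ≤ₙ intervalLength p y

  greedyAfter : Node → ℕ → Bool
  greedyAfter p k = isYes (decide (LongerThan p k))

  count : Bool → ℕ
  count true = 1
  count false = 0

  countAt : Node → ℕ → ℕ
  countAt p k = k +ₙ count (greedyAfter p k)

  countFrom : Node → ℕ → Node → ℕ
  countFrom p k [] = k
  countFrom p k (b ∷ w) = countFrom (p ∷ʳ b) (countAt p k) w

  -- the number of greedy nodes strictly above v, and at or above v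
  above : Node → ℕ
  above v = countFrom [] 0 v

  upTo : Node → ℕ
  upTo v = countAt v (above v)

  greedy : Node → Bool
  greedy v = greedyAfter v (above v)

  Greedy : Node → Set
  Greedy x = greedy x ≡ true

  countFrom-∷ʳ : ∀ w p k b → countFrom p k (w ∷ʳ b) ≡ countAt (p ++ w) (countFrom p k w)
  countFrom-∷ʳ [] p k b = cong (λ q → countAt q k) (sym (++-identityʳ p))
  countFrom-∷ʳ (c ∷ w) p k b = trans (countFrom-∷ʳ w (p ∷ʳ c) (countAt p k) b)
    (cong (λ q → countAt q (countFrom (p ∷ʳ c) (countAt p k) w)) (++-assoc p (c ∷ []) w))

  above-∷ʳ : ∀ v b → above (v ∷ʳ b) ≡ upTo v
  above-∷ʳ v b = countFrom-∷ʳ v [] 0 b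

  above≤upTo : ∀ v → above v ≤ₙ upTo v
  above≤upTo v = ℕP.m≤m+n (above v) _

  upTo-greedy : ∀ v → Greedy v → upTo v ≡ suc (above v)
  upTo-greedy v e = trans (cong (λ q → above v +ₙ count q) e) (ℕP.+-comm (above v) 1)

  upTo-notGreedy : ∀ v → greedy v ≡ false → upTo v ≡ above v
  upTo-notGreedy v e = trans (cong (λ q → above v +ₙ count q) e) (ℕP.+-identityʳ (above v))

  upTo-∷ʳ : ∀ v b → upTo v ≤ₙ upTo (v ∷ʳ b)
  upTo-∷ʳ v b = ℕP.≤-trans (ℕP.≤-reflexive (sym (above-∷ʳ v b))) (above≤upTo (v ∷ʳ b))

  upTo-++ : ∀ w v → upTo v ≤ₙ upTo (v ++ w)
  upTo-++ [] v = ℕP.≤-reflexive (cong upTo (sym (++-identityʳ v)))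
  upTo-++ (b ∷ w) v = ℕP.≤-trans (upTo-∷ʳ v b)
    (ℕP.≤-trans (upTo-++ w (v ∷ʳ b)) (ℕP.≤-reflexive (cong upTo (++-assoc v (b ∷ []) w))))

  upTo-mono : ∀ {u v} → u ⊑ v → upTo u ≤ₙ upTo v
  upTo-mono {u} (w , refl) = upTo-++ w u

  greedy-long : ∀ v → Greedy v → LongerThan v (above v)
  greedy-long v e = isYes-true (decide (LongerThan v (above v))) e

  greedy-source : ∀ v → Greedy v → source I v
  greedy-source v e with greedy-long v e
  ... | y , i , _ = y , i

  -- a branch through x follows its interval with probability p = 2^-(gap x)
  gap : Node → ℕ
  gap x = length (tgt x) ∸ length x

  onLoss onWin : Node → ℚ
  onLoss x = 1ℚ - (halfPow (gap x) + halfPow (gap x))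
  onWin x = 1ℚ + 1ℚ

  start-interval : ∀ x → Greedy x → x ⊑ tgt x × length x <ₙ length (tgt x)
  start-interval x e = interval-strict (tgt-interval (greedy-source x e))

  -- 2p ≤ 1 since intervals have positive gap
  stake≤1 : ∀ x → Greedy x → halfPow (gap x) + halfPow (gap x) ≤ 1ℚ
  stake≤1 x e = ≤-trans (+-mono-≤ (halfPow-anti 1≤gap) (halfPow-anti 1≤gap)) (≤-reflexive (halfPow-split 0))
    where
    1≤gap : 1 ≤ₙ gap x
    1≤gap = ℕP.m<n⇒0<n∸m (proj₂ (start-interval x e))

  onLoss-nonNeg : ∀ x → Greedy x → 0ℚ ≤ onLoss x
  onLoss-nonNeg x e = nonNeg-∸ (stake≤1 x e)

  onWin-nonNeg : ∀ x → Greedy x → 0ℚ ≤ onWin x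
  onWin-nonNeg x _ = 0≤2

  doubling-fair : ∀ p → 0ℚ ≤ p → p + p ≤ 1ℚ → (1ℚ - p) * (1ℚ - (p + p)) + p * (1ℚ + 1ℚ) ≤ 1ℚ
  doubling-fair p 0≤p 2p≤1 = ≤-trans (≤-+nonNeg (p * (1ℚ - (p + p))) (nonNeg-* 0≤p (nonNeg-∸ 2p≤1)))
    (≤-reflexive (solve 1 (λ p → (con 1ℚ :- p) :* (con 1ℚ :- (p :+ p)) :+ p :* (con 1ℚ :+ con 1ℚ)
                                   :+ p :* (con 1ℚ :- (p :+ p)) := con 1ℚ) refl p))

  fair : ∀ x → Greedy x → (1ℚ - halfPow (gap x)) * onLoss x + halfPow (gap x) * onWin x ≤ 1ℚ
  fair x e = doubling-fair (halfPow (gap x)) (halfPow-nonNeg (gap x)) (stake≤1 x e)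

  open Betting.Machine greedy tgt onLoss onWin start-interval onLoss-nonNeg onWin-nonNeg fair

  -- intervals do not nest, so every greedy node gets a bet
  nonNested : NonNested
  nonNested x u gx gu xu ut = nested-equal (tgt-interval (greedy-source x gx)) (tgt-interval (greedy-source u gu)) xu ut

  reserve : ℕ → ℚ
  reserve j = halfPow 1 + halfPow (suc j)

  reserve-anti : ∀ {j k} → j ≤ₙ k → reserve k ≤ reserve j
  reserve-anti {j} {k} l = +-mono-≤ (≤-refl {halfPow 1}) (halfPow-anti {suc j} {suc k} (s≤s l))

  reserve≤1 : ∀ j → reserve j ≤ 1ℚ
  reserve≤1 j = ≤-trans (+-mono-≤ (≤-refl {halfPow 1}) (halfPow-anti {1} {suc j} (s≤s z≤n))) (≤-reflexive (halfPow-split 0))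

  reserve-step : ∀ j → reserve (suc j) ≤ reserve j * (1ℚ - halfPow (suc (suc j)))
  reserve-step j = ≤-trans
    (≤-+nonNeg (½ * a * (½ * 1ℚ - a)) (nonNeg-* (nonNeg-* 0≤½ (halfPow-nonNeg (suc j))) (nonNeg-∸ (halfPow-anti {1} {suc j} (s≤s z≤n)))))
    (≤-reflexive (sym (solve 1 (λ a → (con ½ :* con 1ℚ :+ a) :* (con 1ℚ :- con ½ :* a)
                                      := (con ½ :* con 1ℚ :+ con ½ :* a) :+ con ½ :* a :* (con ½ :* con 1ℚ :- a)) refl a)))
    where
    a : ℚ
    a = halfPow (suc j)

  -- a greedy interval is long, so the loss factor is at least 1 - 2^-(j+2)
  onLoss-lower : ∀ x → Greedy x → 1ℚ - halfPow (suc (suc (above x))) ≤ onLoss x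
  onLoss-lower x e with greedy-long x e
  ... | y , i , long = -∸-anti 1ℚ (≤-trans (+-mono-≤ (halfPow-anti ge) (halfPow-anti ge))
                                        (≤-reflexive (halfPow-split (suc (suc (above x))))))
    where
    ge : suc (suc (suc (above x))) ≤ₙ gap x
    ge = ℕP.≤-trans (s≤s (subst (λ q → suc (suc (above x)) ≤ₙ intervalLength x q) (sym (tgt-unique i)) long))
                    (ℕP.≤-reflexive (sym (ℕP.+-∸-assoc 1 (proj₂ (start-interval x e)))))

  Invariant : Node → State → Set
  Invariant v (idle B c) = twoPow c * reserve (upTo v) ≤ B
  Invariant v (active B c x) = twoPow c * reserve (above x) ≤ B

  invariant-lost : ∀ B c x → Greedy x → twoPow c * reserve (above x) ≤ B →
    twoPow c * reserve (suc (above x)) ≤ B * onLoss x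
  invariant-lost B c x e inv = begin
    twoPow c * reserve (suc j)                   ≤⟨ scaleˡ (twoPow c) (twoPow-nonNeg c) (reserve-step j) ⟩
    twoPow c * (reserve j * (1ℚ - halfPow (suc (suc j)))) ≡⟨ sym (*-assoc (twoPow c) (reserve j) _) ⟩
    twoPow c * reserve j * (1ℚ - halfPow (suc (suc j))) ≤⟨ scaleʳ _ (nonNeg-∸ (halfPow≤1 (suc (suc j)))) inv ⟩
    B * (1ℚ - halfPow (suc (suc j)))              ≤⟨ scaleˡ B 0≤B (onLoss-lower x e) ⟩
    B * onLoss x                                  ∎
    where
    open ≤-Reasoning
    j : ℕ
    j = above x
    0≤B : 0ℚ ≤ B
    0≤B = ≤-trans (nonNeg-* (twoPow-nonNeg c) (nonNeg-+ (halfPow-nonNeg 1) (halfPow-nonNeg (suc j)))) inv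

  invariant-enter : ∀ v b B c → twoPow c * reserve (upTo v) ≤ B → Invariant (v ∷ʳ b) (enter (v ∷ʳ b) B c)
  invariant-enter v b B c inv = enter-elim (Invariant (v ∷ʳ b)) (v ∷ʳ b) B c
    (λ _ → subst (λ q → twoPow c * reserve q ≤ B) (sym (above-∷ʳ v b)) inv)
    (≤-trans (scaleˡ (twoPow c) (twoPow-nonNeg c) (reserve-anti (upTo-∷ʳ v b))) inv)

  invariant-step : ∀ v b s → WellFormed v s → Invariant v s → Invariant (v ∷ʳ b) (step v b s)
  invariant-step v b (idle B c) wf inv = invariant-enter v b B c inv
  invariant-step v b (active B c x) (p , gx , xv , vy , l) inv = step-elim (Invariant (v ∷ʳ b)) v b B c x
    (λ _ → begin
      twoPow (suc c) * reserve (upTo (v ∷ʳ b))   ≤⟨ scaleˡ (twoPow (suc c)) (twoPow-nonNeg (suc c)) (reserve-anti seen-x) ⟩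
      (1ℚ + 1ℚ) * twoPow c * reserve (above x)   ≡⟨ *-assoc (1ℚ + 1ℚ) (twoPow c) (reserve (above x)) ⟩
      (1ℚ + 1ℚ) * (twoPow c * reserve (above x)) ≤⟨ scaleˡ (1ℚ + 1ℚ) 0≤2 inv ⟩
      (1ℚ + 1ℚ) * B                              ≡⟨ *-comm (1ℚ + 1ℚ) B ⟩
      B * onWin x                                ∎)
    (λ _ _ → inv)
    (λ _ → invariant-enter v b (B * onLoss x) c
             (≤-trans (scaleˡ (twoPow c) (twoPow-nonNeg c) (reserve-anti seen)) (invariant-lost B c x gx inv)))
    where
    open ≤-Reasoning
    seen-x : above x ≤ₙ upTo (v ∷ʳ b)
    seen-x = ℕP.≤-trans (above≤upTo x) (upTo-mono (⊑-trans xv (⊑-++ v (b ∷ []))))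
    seen : suc (above x) ≤ₙ upTo v
    seen = ℕP.≤-trans (ℕP.≤-reflexive (sym (upTo-greedy x gx))) (upTo-mono xv)

  invariant-initial : Invariant [] initial
  invariant-initial = enter-elim (Invariant []) [] 1ℚ 0
    (λ _ → ≤-trans (≤-reflexive (*-identityˡ (reserve 0))) (reserve≤1 0))
    (≤-trans (≤-reflexive (*-identityˡ (reserve (upTo [])))) (reserve≤1 (upTo [])))

  invariant : ∀ v → Invariant v (stateAt v)
  invariant v = proj₂ (stateAt-invariant (λ v s → WellFormed v s × Invariant v s)
                         (λ v b s (wf , inv) → wellFormed-step v b s wf , invariant-step v b s wf inv)
                         (wellFormed [] , invariant-initial) v)

  CompletedBelow : Branch → Node → Set
  CompletedBelow π u = Σ Node λ x → x ∈B π × u ⊑ x × Greedy x × Σ Node λ y → y ∈B π × I x y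

  completed-below : ∀ π → ¬ FinitelyCompleted Greedy π → ∀ u → u ∈B π → CompletedBelow π u
  completed-below π nf u uπ with decide (CompletedBelow π u)
  ... | yes c = c
  ... | no nc = ⊥-elim (nf (u , uπ , λ x xπ ux gx y yπ i → nc (x , xπ , ux , proj₁ gx , y , yπ , i)))

  -- (The proofs below destructure evidence by helper functions with explicit
  -- types rather than by  with, which would normalise the machine's states.)
  module Along (π : Branch) (nf : ¬ FinitelyCompleted Greedy π) where

    WonAfter : ℕ → Set
    WonAfter n = Σ ℕ λ m → Σ ℚ λ B → Σ ℕ λ c → stateAt (prefix π m) ≡ idle B c × completions (stateAt (prefix π n)) <ₙ c

    win-beyond : ∀ n → WonAfter n
    win-beyond n = bet-on (completed-below π nf (prefix π n) (prefix-on π n))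
      where
      bet-on : CompletedBelow π (prefix π n) → WonAfter n
      bet-on (x , xπ , nx , gx , y , yπ , ixy) = placed (active-at-start nonNested π (length x) (subst Greedy xπ gx))
        where
        placed : Σ ℚ (λ B → Σ ℕ λ c → stateAt (prefix π (length x)) ≡ active B c (prefix π (length x))) → WonAfter n
        placed (B , c , E₀) = length (tgt x) , B * onWin x , suc c , W , s≤s before
          where
          E : stateAt (prefix π (length x)) ≡ active B c x
          E = trans E₀ (cong (active B c) (sym xπ))
          tπ : tgt x ∈B π
          tπ = subst (_∈B π) (sym (tgt-unique ixy)) yπ
          n≤ : n ≤ₙ length x
          n≤ = ℕP.≤-trans (ℕP.≤-reflexive (sym (prefix-length π n))) (⊑-length nx)
          before : completions (stateAt (prefix π n)) ≤ₙ c
          before = subst (λ s → completions (stateAt (prefix π n)) ≤ₙ completions s) E (completions-mono π n (length x) n≤)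
          W : stateAt (prefix π (length (tgt x))) ≡ idle (B * onWin x) (suc c)
          W = trans (cong stateAt (sym tπ)) (won-at-target π (length x) x B c E tπ)

    IdleWith : ℕ → Set
    IdleWith j = Σ ℕ λ n → Σ ℚ λ B → Σ ℕ λ c → stateAt (prefix π n) ≡ idle B c × j ≤ₙ c

    completions-unbounded : ∀ j → IdleWith j
    completions-unbounded zero = first (win-beyond 0)
      where
      first : WonAfter 0 → IdleWith 0
      first (m , B , c , E , _) = m , B , c , E , z≤n
    completions-unbounded (suc j) = next (completions-unbounded j)
      where
      next : IdleWith j → IdleWith (suc j)
      next (n , B , c , E , j≤c) = later (win-beyond n)
        where
        later : WonAfter n → IdleWith (suc j)
        later (m , B' , c' , E' , more) = m , B' , c' , E' , ℕP.≤-trans (s≤s j≤c) (subst (λ s → completions s <ₙ c') E more)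

    -- with ≥ k + 1 won bets the value is ≥ 2^(k+1) · ½
    value-unbounded : UnboundedOn (λ v → value v (stateAt v)) π
    value-unbounded k = large (completions-unbounded (suc k))
      where
      large : IdleWith (suc k) → Σ ℕ λ n → twoPow k ≤ value (prefix π n) (stateAt (prefix π n))
      large (n , B , c , E , k<c) = n , (begin
        twoPow k                         ≡⟨ sym (half-twoPow k) ⟩
        ½ * twoPow (suc k)               ≤⟨ scaleˡ ½ 0≤½ (twoPow-mono k<c) ⟩
        ½ * twoPow c                     ≡⟨ solve 1 (λ t → con ½ :* t := t :* (con ½ :* con 1ℚ)) refl (twoPow c) ⟩
        twoPow c * halfPow 1             ≤⟨ scaleˡ (twoPow c) (twoPow-nonNeg c) (≤-+nonNeg (halfPow (suc u)) (halfPow-nonNeg (suc u))) ⟩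
        twoPow c * reserve u             ≤⟨ subst (Invariant (prefix π n)) E (invariant (prefix π n)) ⟩
        B                                ≡⟨ cong (value (prefix π n)) (sym E) ⟩
        value (prefix π n) (stateAt (prefix π n)) ∎)
        where
        open ≤-Reasoning
        u : ℕ
        u = upTo (prefix π n)

  greedy-finitelyCompleted : Null (λ π → ¬ FinitelyCompleted Greedy π)
  greedy-finitelyCompleted = ville (λ v → value v (stateAt v)) (value-nonNeg , value-super) value-root
                                   (λ π nf → Along.value-unbounded π nf)

  -- If π has no greedy source below u, its lengths are bounded: below u the
  -- greedy count stays at its value c₀ at u, so no interval there is longer
  -- than c₀ + 1, and the finitely many intervals above u are bounded too.
  no-greedy-bounded : ∀ π u → u ∈B π → ¬ (Σ Node λ x → x ∈B π × u ⊑ x × (Greedy x × source I x)) →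
    Σ ℕ λ L → ∀ x y → I x y → x ∈B π → intervalLength x y <ₙ L
  no-greedy-bounded π u uπ none = B₀ +ₙ suc (suc c₀) , bounded
    where
    d : ℕ
    d = length u
    notGreedy : ∀ m → d ≤ₙ m → greedy (prefix π m) ≡ false
    notGreedy m l = isYes-false-bool (greedy (prefix π m)) (λ e → none (prefix π m , prefix-on π m ,
                      on-⊑ uπ (prefix-on π m) (ℕP.≤-trans l (ℕP.≤-reflexive (sym (prefix-length π m)))) ,
                      e , greedy-source (prefix π m) e))
      where
      isYes-false-bool : ∀ b → ¬ (b ≡ true) → b ≡ false
      isYes-false-bool true ne = ⊥-elim (ne refl)
      isYes-false-bool false _ = refl
    c₀ : ℕ
    c₀ = above (prefix π d)
    above-constant : ∀ t → above (prefix π (d +ₙ t)) ≡ c₀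
    above-constant zero = cong (λ m → above (prefix π m)) (ℕP.+-identityʳ d)
    above-constant (suc t) = begin
      above (prefix π (d +ₙ suc t))           ≡⟨ cong (λ m → above (prefix π m)) (ℕP.+-suc d t) ⟩
      above (prefix π (suc (d +ₙ t)))         ≡⟨ cong above (prefix-∷ʳ π (d +ₙ t)) ⟩
      above (prefix π (d +ₙ t) ∷ʳ π (d +ₙ t)) ≡⟨ above-∷ʳ (prefix π (d +ₙ t)) (π (d +ₙ t)) ⟩
      upTo (prefix π (d +ₙ t))                ≡⟨ upTo-notGreedy (prefix π (d +ₙ t)) (notGreedy (d +ₙ t) (ℕP.m≤m+n d t)) ⟩
      above (prefix π (d +ₙ t))               ≡⟨ above-constant t ⟩
      c₀                                      ∎
      where open ≡-Reasoning
    shallow : Σ ℕ λ B₀ → ∀ x y → I x y → x ∈B π → length x <ₙ d → intervalLength x y ≤ₙ B₀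
    shallow = shallow-bound π d
    B₀ : ℕ
    B₀ = proj₁ shallow
    bounded : ∀ x y → I x y → x ∈B π → intervalLength x y <ₙ B₀ +ₙ suc (suc c₀)
    bounded x y i xπ = by-depth (length x ℕ.<? d)
      where
      by-depth : Dec (length x <ₙ d) → intervalLength x y <ₙ B₀ +ₙ suc (suc c₀)
      by-depth (yes lt) = ℕP.≤-trans (s≤s (proj₂ shallow x y i xπ lt)) (ℕP.m<m+n B₀ (s≤s z≤n))
      by-depth (no nlt) = ℕP.≰⇒> (λ long → isYes-false (decide (LongerThan x (above x))) notG
                            (y , i , ℕP.≤-trans (ℕP.≤-reflexive (cong (λ q → suc (suc q)) above-x))
                                                (ℕP.≤-trans (ℕP.m≤n+m (suc (suc c₀)) B₀) long)))
        where
        d≤ : d ≤ₙ length x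
        d≤ = ℕP.≮⇒≥ nlt
        notG : greedy x ≡ false
        notG = subst (λ q → greedy q ≡ false) (sym xπ) (notGreedy (length x) d≤)
        above-x : above x ≡ c₀
        above-x = trans (cong above xπ)
          (trans (cong (λ m → above (prefix π m)) (sym (ℕP.m+[n∸m]≡n d≤))) (above-constant (length x ∸ d)))

  limsup⇒hits : ∀ π → LimsupInfinite I π → HitsInfinitely Greedy π
  limsup⇒hits π ls u uπ = decide-greedy (decide (Σ Node λ x → x ∈B π × u ⊑ x × (Greedy x × source I x)))
    where
    decide-greedy : Dec (Σ Node λ x → x ∈B π × u ⊑ x × (Greedy x × source I x)) →
                    Σ Node λ x → x ∈B π × u ⊑ x × (Greedy x × source I x)
    decide-greedy (yes w) = w
    decide-greedy (no none) = ⊥-elim (unbounded (no-greedy-bounded π u uπ none))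
      where
      unbounded : ¬ (Σ ℕ λ L → ∀ x y → I x y → x ∈B π → intervalLength x y <ₙ L)
      unbounded (L , bnd) = let (x , y , i , xπ , long) = ls L in ℕP.<⇒≱ (bnd x y i xπ) long

-- For an arbitrary set W, let the machine bet
-- against every interval with source in W, at odds  onLoss = 1 + p/2  and
-- onWin = ½,  p = 2^-(gap): the bet is fair or worse.  On a branch where the
-- lengths are bounded by L, W-sources occur infinitely often, and beyond
-- some node u no W-interval is completed, every bet placed below u is lost
-- and multiplies the capital by at least r = 1 + 2^-(L+1); hence the
-- capital, and with it the value (≥ capital/2), is unbounded.  By Ville's
-- criterion such branches form a null set.
module Bounded (em : ExcludedMiddle (lsuc 0ℓ)) (I : Node → Node → Set) (IF : IntervalFamily I) (W : Node → Set) where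

  open Dyadic
  open Tree
  open NullSets using (UnboundedOn; ville)
  open Decisions em
  open Families em I IF
  open import Data.Bool using (Bool; true)
  open import Data.List using ([]; _∷ʳ_; length)
  open import Data.Nat as ℕ using (ℕ; zero; suc; _∸_) renaming (_≤_ to _≤ₙ_; _<_ to _<ₙ_; _+_ to _+ₙ_)
  import Data.Nat.Properties as ℕP
  open import Data.Rational using (ℚ; 0ℚ; 1ℚ; ½; _+_; _*_; _-_; _≤_)
  open import Data.Rational.Properties using (≤-refl; ≤-trans; ≤-reflexive; +-mono-≤; *-comm; *-identityʳ; module ≤-Reasoning)
  open import Data.Product using (Σ; _×_; _,_; proj₁; proj₂)
  open import Data.Sum using (_⊎_; inj₁; inj₂)
  open import Data.Empty using (⊥-elim)
  open import Relation.Nullary using (¬_)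
  open import Relation.Nullary.Decidable using (isYes)
  open import Relation.Binary.PropositionalEquality
  open import Data.Rational.Solver
  open +-*-Solver

  Start : Node → Set
  Start x = W x × source I x

  start : Node → Bool
  start x = isYes (decide (Start x))

  start-sound : ∀ {x} → start x ≡ true → Start x
  start-sound {x} e = isYes-true (decide (Start x)) e

  -- a branch through x follows its interval with probability p = 2^-(gap x)
  gap : Node → ℕ
  gap x = length (tgt x) ∸ length x

  onLoss onWin : Node → ℚ
  onLoss x = 1ℚ + ½ * halfPow (gap x)
  onWin x = ½

  start-interval : ∀ x → start x ≡ true → x ⊑ tgt x × length x <ₙ length (tgt x)
  start-interval x e = interval-strict (tgt-interval (proj₂ (start-sound e)))

  1≤onLoss : ∀ x → 1ℚ ≤ onLoss x
  1≤onLoss x = ≤-+nonNeg (½ * halfPow (gap x)) (nonNeg-* 0≤½ (halfPow-nonNeg (gap x)))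

  -- (1 - p)(1 + p/2) + p/2 = 1 - p²/2
  halving-fair : ∀ p → 0ℚ ≤ p → (1ℚ - p) * (1ℚ + ½ * p) + p * ½ ≤ 1ℚ
  halving-fair p 0≤p = ≤-trans (≤-+nonNeg (½ * (p * p)) (nonNeg-* 0≤½ (nonNeg-* 0≤p 0≤p)))
    (≤-reflexive (solve 1 (λ p → (con 1ℚ :- p) :* (con 1ℚ :+ con ½ :* p) :+ p :* con ½ :+ con ½ :* (p :* p) := con 1ℚ) refl p))

  fair : ∀ x → start x ≡ true → (1ℚ - halfPow (gap x)) * onLoss x + halfPow (gap x) * onWin x ≤ 1ℚ
  fair x _ = halving-fair (halfPow (gap x)) (halfPow-nonNeg (gap x))

  open Betting.Machine start tgt onLoss onWin start-interval
    (λ x _ → ≤-trans 0≤1 (1≤onLoss x)) (λ _ _ → 0≤½) fair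

  -- intervals do not nest, so every W-source gets a bet
  nonNested : NonNested
  nonNested x u sx su xu ut = nested-equal (tgt-interval (proj₂ (start-sound sx))) (tgt-interval (proj₂ (start-sound su))) xu ut

  ≤*onLoss : ∀ {B} x → 0ℚ ≤ B → B ≤ B * onLoss x
  ≤*onLoss {B} x p = ≤-trans (≤-reflexive (sym (*-identityʳ B))) (scaleˡ B p (1≤onLoss x))

  -- the capital at v is at least 2^-|v|: only won bets decrease it, by ½
  capital-lower : ∀ v → halfPow (length v) ≤ capital (stateAt v)
  capital-lower = stateAt-invariant (λ v s → halfPow (length v) ≤ capital s) lower-step
    (≤-reflexive (sym (capital-enter [] 1ℚ 0)))
    where
    halved : ∀ v b {B} → halfPow (length v) ≤ B → halfPow (length (v ∷ʳ b)) ≤ ½ * B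
    halved v b p = subst (_≤ _) (cong halfPow (sym (length-∷ʳ v b))) (scaleˡ ½ 0≤½ p)
    dropped : ∀ v b {B} → halfPow (length v) ≤ B → halfPow (length (v ∷ʳ b)) ≤ B
    dropped v b {B} p = ≤-trans (halved v b p) (half≤ B (≤-trans (halfPow-nonNeg (length v)) p))
    lower-step : ∀ v b s → halfPow (length v) ≤ capital s → halfPow (length (v ∷ʳ b)) ≤ capital (step v b s)
    lower-step v b (idle B c) p = subst (_ ≤_) (sym (capital-enter (v ∷ʳ b) B c)) (dropped v b p)
    lower-step v b (active B c x) p = step-elim (λ s → halfPow (length (v ∷ʳ b)) ≤ capital s) v b B c x
      (λ _ → ≤-trans (halved v b p) (≤-reflexive (*-comm ½ B)))
      (λ _ _ → dropped v b p)
      (λ _ → subst (_ ≤_) (sym (capital-enter (v ∷ʳ b) (B * onLoss x) c))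
                  (≤-trans (dropped v b p) (≤*onLoss x (≤-trans (halfPow-nonNeg (length v)) p))))

  capital-nonNeg : ∀ v s → WellFormed v s → 0ℚ ≤ capital s
  capital-nonNeg v (idle B c) p = p
  capital-nonNeg v (active B c x) (p , _) = p

  -- every bet factor is at least ½, so the value is at least half the capital
  half-capital≤value : ∀ v s → WellFormed v s → ½ * capital s ≤ value v s
  half-capital≤value v (idle B c) p = half≤ B p
  half-capital≤value v (active B c x) (p , _) = ≤-trans (≤-reflexive (*-comm ½ B)) (scaleˡ B p half≤factor)
    where
    q : ℚ
    q = winProb v x
    q≤1 : q ≤ 1ℚ
    q≤1 = halfPow≤1 (length (tgt x) ∸ length v)
    t : ℚ
    t = halfPow (gap x)
    half≤factor : ½ ≤ (1ℚ - q) * onLoss x + q * onWin x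
    half≤factor = ≤-trans
      (≤-+nonNeg (½ * (1ℚ - q) + ½ * ((1ℚ - q) * t))
                 (nonNeg-+ (nonNeg-* 0≤½ (nonNeg-∸ q≤1)) (nonNeg-* 0≤½ (nonNeg-* (nonNeg-∸ q≤1) (halfPow-nonNeg (gap x))))))
      (≤-reflexive (solve 2 (λ q t → con ½ :+ (con ½ :* (con 1ℚ :- q) :+ con ½ :* ((con 1ℚ :- q) :* t))
                                       := (con 1ℚ :- q) :* (con 1ℚ :+ con ½ :* t) :+ q :* con ½) refl q t))

  Rich : ℕ → ℚ → State → Set
  Rich d₀ T (idle B c) = T ≤ B
  Rich d₀ T (active B c x) = T ≤ B × d₀ ≤ₙ length x

  Rich-enter : ∀ d₀ T u B c → T ≤ B → d₀ ≤ₙ length u → Rich d₀ T (enter u B c)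
  Rich-enter d₀ T u B c tb du = enter-elim (Rich d₀ T) u B c (λ _ → tb , du) tb

  Rich-anti : ∀ d₀ T T' s → T' ≤ T → Rich d₀ T s → Rich d₀ T' s
  Rich-anti d₀ T T' (idle B c) le g = ≤-trans le g
  Rich-anti d₀ T T' (active B c x) le (g , l) = ≤-trans le g , l

  Rich-capital : ∀ d₀ T s → Rich d₀ T s → T ≤ capital s
  Rich-capital d₀ T (idle B c) g = g
  Rich-capital d₀ T (active B c x) (g , _) = g

  Bad : Branch → Set
  Bad π = ¬ LimsupInfinite I π × HitsInfinitely W π × FinitelyCompleted W π

  module Along (π : Branch) (u : Node) (uπ : u ∈B π)
               (fc : ∀ x → x ∈B π → u ⊑ x → Start x → ∀ y → y ∈B π → ¬ I x y) where

    d₀ : ℕ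
    d₀ = length u

    at : ℕ → State
    at n = stateAt (prefix π n)

    wellFormedAt : ∀ n {s} → at n ≡ s → WellFormed (prefix π n) s
    wellFormedAt n e = subst (WellFormed (prefix π n)) e (wellFormed (prefix π n))

    bet-placed : ∀ x → x ∈B π → Start x → Σ ℚ λ B → Σ ℕ λ c → stateAt x ≡ active B c x
    bet-placed x xπ Sx =
      let (B , c , E) = active-at-start nonNested π (length x)
                          (subst (λ w → start w ≡ true) xπ (isYes-complete (decide (Start x)) Sx))
      in B , c , trans (cong stateAt xπ) (trans E (cong (active B c) (sym xπ)))

    Continues : ℕ → ℚ → ℕ → Node → Set
    Continues n B c x = (at (suc n) ≡ active B c x) ⊎ (at (suc n) ≡ enter (prefix π (suc n)) (B * onLoss x) c)

    -- a bet placed below u is never won on π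
    active-step : ∀ n B c x → at n ≡ active B c x → d₀ ≤ₙ length x → Continues n B c x
    active-step n B c x E dx = relabel outcome
      where
      v : Node
      v = prefix π n
      wf : WellFormed v (active B c x)
      wf = wellFormedAt n E
      Sx : Start x
      Sx = start-sound (proj₁ (proj₂ wf))
      xπ : x ∈B π
      xπ = ⊑-on (proj₁ (proj₂ (proj₂ wf))) (prefix-on π n)
      Outcome : State → Set
      Outcome s = s ≡ active B c x ⊎ s ≡ enter (v ∷ʳ π n) (B * onLoss x) c
      never-won : (v ∷ʳ π n) ≡ tgt x → Outcome (idle (B * onWin x) (suc c))
      never-won e = ⊥-elim (fc x xπ (on-⊑ uπ xπ dx) Sx (tgt x)
                              (subst (_∈B π) (trans (prefix-∷ʳ π n) e) (prefix-on π (suc n))) (tgt-interval (proj₂ Sx)))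
      outcome : Outcome (step v (π n) (active B c x))
      outcome = step-elim Outcome v (π n) B c x never-won (λ _ _ → inj₁ refl) (λ _ → inj₂ refl)
      base : at (suc n) ≡ step v (π n) (active B c x)
      base = trans (stateAt-suc π n) (cong (step v (π n)) E)
      relabel : Outcome (step v (π n) (active B c x)) → Continues n B c x
      relabel (inj₁ e) = inj₁ (trans base e)
      relabel (inj₂ e) = inj₂ (trans base (trans e (cong (λ w → enter w (B * onLoss x) c) (sym (prefix-∷ʳ π n)))))

    d₀≤suc : ∀ {n} → d₀ ≤ₙ n → d₀ ≤ₙ length (prefix π (suc n))
    d₀≤suc {n} dn = ℕP.≤-trans (ℕP.m≤n⇒m≤1+n dn) (ℕP.≤-reflexive (sym (prefix-length π (suc n))))

    rich-step : ∀ T n → d₀ ≤ₙ n → Rich d₀ T (at n) → Rich d₀ T (at (suc n))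
    rich-step T n dn rich = by-state (at n) refl rich
      where
      by-state : ∀ s → at n ≡ s → Rich d₀ T s → Rich d₀ T (at (suc n))
      by-state (idle B c) E T≤B = subst (Rich d₀ T)
        (sym (trans (stateAt-suc π n)
               (trans (cong (step (prefix π n) (π n)) E) (cong (λ w → enter w B c) (sym (prefix-∷ʳ π n))))))
        (Rich-enter d₀ T (prefix π (suc n)) B c T≤B (d₀≤suc dn))
      by-state (active B c x) E (T≤B , dx) = continue (active-step n B c x E dx)
        where
        continue : Continues n B c x → Rich d₀ T (at (suc n))
        continue (inj₁ e) = subst (Rich d₀ T) (sym e) (T≤B , dx)
        continue (inj₂ e) = subst (Rich d₀ T) (sym e) (Rich-enter d₀ T (prefix π (suc n)) (B * onLoss x) c
          (≤-trans T≤B (≤*onLoss x (capital-nonNeg (prefix π n) (active B c x) (wellFormedAt n E)))) (d₀≤suc dn))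

    rich-forever : ∀ T n → d₀ ≤ₙ n → Rich d₀ T (at n) → ∀ m → n ≤ₙ m → Rich d₀ T (at m)
    rich-forever T n dn = ≤-induction {P = λ m → Rich d₀ T (at m)} (λ m n≤m → rich-step T m (ℕP.≤-trans dn n≤m))

    Pending : ℚ → ℕ → Node → ℕ → Set
    Pending B c x m = (at m ≡ active B c x) ⊎ Rich d₀ (B * onLoss x) (at m)

    pending-step : ∀ B c x m → d₀ ≤ₙ length x → d₀ ≤ₙ m → Pending B c x m → Pending B c x (suc m)
    pending-step B c x m dx dm (inj₁ E) = continue (active-step m B c x E dx)
      where
      continue : Continues m B c x → Pending B c x (suc m)
      continue (inj₁ e) = inj₁ e
      continue (inj₂ e) = inj₂ (subst (Rich d₀ (B * onLoss x)) (sym e)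
                                  (Rich-enter d₀ (B * onLoss x) (prefix π (suc m)) (B * onLoss x) c ≤-refl (d₀≤suc dm)))
    pending-step B c x m dx dm (inj₂ rich) = inj₂ (rich-step (B * onLoss x) m dm rich)

    bet-lost : ∀ B c x → x ∈B π → d₀ ≤ₙ length x → stateAt x ≡ active B c x →
      Rich d₀ (B * onLoss x) (at (length (tgt x)))
    bet-lost B c x xπ dx E = finished
      (≤-induction {P = Pending B c x} (λ m x≤m → pending-step B c x m dx (ℕP.≤-trans dx x≤m)) (inj₁ E₀)
                   (length (tgt x)) (ℕP.<⇒≤ (proj₂ (start-interval x (proj₁ (proj₂ (wellFormedAt (length x) E₀)))))))
      where
      E₀ : at (length x) ≡ active B c x
      E₀ = trans (cong stateAt (sym xπ)) E
      finished : Pending B c x (length (tgt x)) → Rich d₀ (B * onLoss x) (at (length (tgt x)))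
      finished (inj₁ E') = ⊥-elim (ℕP.<-irrefl (prefix-length π (length (tgt x)))
                                  (proj₂ (proj₂ (proj₂ (proj₂ (wellFormedAt (length (tgt x)) E'))))))
      finished (inj₂ rich) = rich

    module Bounded-by (L : ℕ) (lb : ∀ x y → I x y → x ∈B π → intervalLength x y <ₙ L) (his : HitsInfinitely W π) where

      r : ℚ
      r = 1ℚ + halfPow (suc L)

      0≤r : 0ℚ ≤ r
      0≤r = nonNeg-+ 0≤1 (halfPow-nonNeg (suc L))

      -- every bet on π loses at least the factor r, as gap ≤ L
      onLoss-bound : ∀ x → x ∈B π → Start x → r ≤ onLoss x
      onLoss-bound x xπ Sx = +-mono-≤ (≤-refl {1ℚ}) (scaleˡ ½ 0≤½ (halfPow-anti gap≤L))
        where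
        i : I x (tgt x)
        i = tgt-interval (proj₂ Sx)
        gap≤L : gap x ≤ₙ L
        gap≤L = ℕP.≤-trans (ℕP.≤-reflexive (ℕP.+-∸-assoc 1 (proj₂ (interval-strict i)))) (lb x (tgt x) i xπ)

      Reaches : ℚ → Set
      Reaches T = Σ ℕ λ n → d₀ ≤ₙ n × Rich d₀ T (at n)

      reaches-start : Σ ℕ λ n₁ → Reaches (halfPow n₁)
      reaches-start = first (his u uπ)
        where
        first : Σ Node (λ x → x ∈B π × u ⊑ x × Start x) → Σ ℕ λ n₁ → Reaches (halfPow n₁)
        first (x , xπ , ux , Sx) = placed (bet-placed x xπ Sx)
          where
          placed : Σ ℚ (λ B → Σ ℕ λ c → stateAt x ≡ active B c x) → Σ ℕ λ n₁ → Reaches (halfPow n₁)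
          placed (B , c , E) = length x , length x , ⊑-length ux ,
            subst (Rich d₀ (halfPow (length x))) (sym (trans (cong stateAt (sym xπ)) E))
                  (subst (halfPow (length x) ≤_) (cong capital E) (capital-lower x) , ⊑-length ux)

      reaches-step : ∀ T → 0ℚ ≤ T → Reaches T → Reaches (T * r)
      reaches-step T 0≤T (n , dn , rich) = next (his (prefix π n) (prefix-on π n))
        where
        next : Σ Node (λ x → x ∈B π × prefix π n ⊑ x × Start x) → Reaches (T * r)
        next (x , xπ , nx , Sx) = placed (bet-placed x xπ Sx)
          where
          n≤ : n ≤ₙ length x
          n≤ = ℕP.≤-trans (ℕP.≤-reflexive (sym (prefix-length π n))) (⊑-length nx)
          dx : d₀ ≤ₙ length x
          dx = ℕP.≤-trans dn n≤
          placed : Σ ℚ (λ B → Σ ℕ λ c → stateAt x ≡ active B c x) → Reaches (T * r)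
          placed (B , c , E) = length (tgt x) , ℕP.≤-trans dx (ℕP.<⇒≤ (proj₂ (interval-strict (tgt-interval (proj₂ Sx))))) ,
            Rich-anti d₀ (B * onLoss x) (T * r) _ (*-mono-nonNeg 0≤T 0≤r T≤B (onLoss-bound x xπ Sx)) (bet-lost B c x xπ dx E)
            where
            T≤B : T ≤ B
            T≤B = proj₁ (subst (Rich d₀ T) (trans (cong stateAt (sym xπ)) E) (rich-forever T n dn rich (length x) n≤))

      reaches-pow : ∀ j T → 0ℚ ≤ T → Reaches T → Reaches (T * pow r j)
      reaches-pow zero T 0≤T reach = subst Reaches (sym (*-identityʳ T)) reach
      reaches-pow (suc j) T 0≤T reach =
        subst Reaches (solve 3 (λ t p q → t :* p :* q := t :* (q :* p)) refl T (pow r j) r)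
              (reaches-step (T * pow r j) (nonNeg-* 0≤T (pow-nonNeg j 0≤r)) (reaches-pow j T 0≤T reach))

  value-unbounded : ∀ π → Bad π → UnboundedOn (λ v → value v (stateAt v)) π
  value-unbounded π (nls , his , (u , uπ , fc)) k = n , (begin
    twoPow k                       ≡⟨ sym (half-twoPow k) ⟩
    ½ * twoPow (suc k)             ≤⟨ scaleˡ ½ 0≤½ growth ⟩
    ½ * T                          ≤⟨ scaleˡ ½ 0≤½ (Rich-capital d₀ T (stateAt (prefix π n)) (proj₂ (proj₂ reached))) ⟩
    ½ * capital (stateAt (prefix π n)) ≤⟨ half-capital≤value (prefix π n) (stateAt (prefix π n)) (wellFormed (prefix π n)) ⟩
    value (prefix π n) (stateAt (prefix π n)) ∎)
    where
    open ≤-Reasoning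
    open Along π u uπ fc
    L : ℕ
    L = proj₁ (bounded-lengths nls)
    open Bounded-by L (proj₂ (bounded-lengths nls)) his
    n₁ t : ℕ
    n₁ = proj₁ reaches-start
    t = n₁ +ₙ suc k
    T : ℚ
    T = halfPow n₁ * pow r (2^ (suc L) ℕ.* t)
    reached : Reaches T
    reached = reaches-pow (2^ (suc L) ℕ.* t) (halfPow n₁) (halfPow-nonNeg n₁) (proj₂ reaches-start)
    n : ℕ
    n = proj₁ reached
    -- 2^(k+1) = 2^-n₁ · 2^t ≤ 2^-n₁ · r^(2^(L+1) t)  (Bernoulli)
    growth : twoPow (suc k) ≤ T
    growth = ≤-trans (≤-reflexive (sym (halfPow*twoPow n₁ (suc k))))
                     (scaleˡ (halfPow n₁) (halfPow-nonNeg n₁) (bernoulli (suc L) t))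

  bounded-null : Null Bad
  bounded-null = ville (λ v → value v (stateAt v)) (value-nonNeg , value-super) value-root value-unbounded

-- The formula φ and its meaning.  Set variables: 0 = sources, 1 = targets,
-- 2 = Z, 3 = the quantified W; node variables 0–4; branch variable 0.
module Definability where

  open import Level using (lift; lower)
  open import Data.Product using (Σ; _×_; _,_; proj₁; proj₂)
  open import Data.Sum using (_⊎_; inj₁; inj₂)
  open import Data.Empty using (⊥-elim)
  open import Relation.Nullary using (¬_; yes; no)
  open import Relation.Binary.PropositionalEquality using (subst; sym)
  open import Data.List using (length)
  open import Data.Nat using (ℕ)
  import Data.Nat.Properties as ℕP
  open Tree
  open NullSets using (Null-mono; Null-∪)

  _⇒'_ : Formula → Formula → Formula
  a ⇒' b = (¬' a) ∨' b

  _<ⁿ_ : ℕ → ℕ → Formula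
  a <ⁿ b = (a ≤ⁿ b) ∧' (¬' (b ≤ⁿ a))

  onBranch : ℕ → Formula
  onBranch u = u ∈ᵇ 0

  MeetsZ : Formula
  MeetsZ = ∀ⁿ 0 (onBranch 0 ⇒' ∃ⁿ 1 (onBranch 1 ∧' ((0 ≤ⁿ 1) ∧' (1 ∈ˢ 2))))

  WSourceBelow : Formula
  WSourceBelow = onBranch 1 ∧' ((0 ≤ⁿ 1) ∧' ((1 ∈ˢ 3) ∧' (1 ∈ˢ 0)))

  HitsW : Formula
  HitsW = ∀ⁿ 0 (onBranch 0 ⇒' ∃ⁿ 1 WSourceBelow)

  PartnerF : Formula
  PartnerF = (2 ∈ˢ 1) ∧' ((1 <ⁿ 2) ∧' (¬' (∃ⁿ 4 ((4 ∈ˢ 0) ∧' ((1 <ⁿ 4) ∧' (4 <ⁿ 2))))))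

  FinitelyCompletedW : Formula
  FinitelyCompletedW = ∃ⁿ 0 (onBranch 0 ∧' ∀ⁿ 1 (WSourceBelow ⇒' ∀ⁿ 2 (onBranch 2 ⇒' (¬' PartnerF))))

  φ : Formula
  φ = ∀ˢ 3 (∇ 0 ((HitsW ∧' FinitelyCompletedW) ⇒' MeetsZ)) ∧' ∃ˢ 3 (∇ 0 (MeetsZ ⇒' (HitsW ∧' FinitelyCompletedW)))

  module Meaning (em : ExcludedMiddle (lsuc 0ℓ)) (I : Node → Node → Set) (IF : IntervalFamily I)
                 (Z : Node → Set) (ρ : Env) where

    open Decisions em
    open Families em I IF
    module G = Greedy em I IF
    module B (W : Node → Set) = Bounded em I IF W

    ρ₀ : Env
    ρ₀ = ((ρ [s 0 ↦ source I ]) [s 1 ↦ target I ]) [s 2 ↦ Z ]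

    env : (Node → Set) → Branch → Env
    env W π = (ρ₀ [s 3 ↦ W ]) [b 0 ↦ π ]

    MeetsBelow : Branch → Set
    MeetsBelow π = ∀ u → u ∈B π → Σ Node λ z → z ∈B π × u ⊑ z × Z z

    meetsZ-sound : ∀ W π → ⟦ MeetsZ ⟧ (env W π) → MeetsBelow π
    meetsZ-sound W π s u uπ with s u
    ... | inj₁ n = ⊥-elim (n (lift uπ))
    ... | inj₂ (z , lift zπ , lift uz , lift zz) = z , zπ , uz , zz

    meetsZ-complete : ∀ W π → MeetsBelow π → ⟦ MeetsZ ⟧ (env W π)
    meetsZ-complete W π f x with decide (x ∈B π)
    ... | no n = inj₁ (λ l → n (lower l))
    ... | yes xπ with f x xπ
    ...   | z , zπ , xz , zz = inj₂ (z , lift zπ , lift xz , lift zz)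

    hits-sound : ∀ W π → ⟦ HitsW ⟧ (env W π) → HitsInfinitely W π
    hits-sound W π s u uπ with s u
    ... | inj₁ n = ⊥-elim (n (lift uπ))
    ... | inj₂ (z , lift zπ , lift uz , lift wz , lift sz) = z , zπ , uz , wz , sz

    hits-complete : ∀ W π → HitsInfinitely W π → ⟦ HitsW ⟧ (env W π)
    hits-complete W π f x with decide (x ∈B π)
    ... | no n = inj₁ (λ l → n (lower l))
    ... | yes xπ with f x xπ
    ...   | z , zπ , xz , wz , sz = inj₂ (z , lift zπ , lift xz , lift wz , lift sz)

    -- PartnerF expresses  Partner,  which for sources is membership in 𝓘
    finitelyCompleted-sound : ∀ W π → ⟦ FinitelyCompletedW ⟧ (env W π) → FinitelyCompleted W π
    finitelyCompleted-sound W π (u , lift uπ , g) = u , uπ , none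
      where
      none : ∀ x → x ∈B π → u ⊑ x → (W x × source I x) → ∀ y → y ∈B π → ¬ I x y
      none x xπ ux (wx , sx) y yπ i with g x
      ... | inj₁ n = n (lift xπ , lift ux , lift wx , lift sx)
      ... | inj₂ g' with g' y
      ...   | inj₁ n = n (lift yπ)
      ...   | inj₂ np with interval⇒partner i
      ...     | ty , (xy , nyx) , nz = np (lift ty , (lift xy , (λ q → nyx (lower q))) ,
                   λ { (z , lift sz , (lift xz , nzx) , (lift zy , nyz)) →
                         nz (z , sz , (xz , λ q → nzx (lift q)) , (zy , λ q → nyz (lift q))) })

    finitelyCompleted-complete : ∀ W π → FinitelyCompleted W π → ⟦ FinitelyCompletedW ⟧ (env W π)
    finitelyCompleted-complete W π (u , uπ , f) = u , lift uπ , below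
      where
      below : (x : Node) → ⟦ WSourceBelow ⇒' ∀ⁿ 2 (onBranch 2 ⇒' (¬' PartnerF)) ⟧ ((env W π [n 0 ↦ u ]) [n 1 ↦ x ])
      below x with decide (x ∈B π × u ⊑ x × W x × source I x)
      ... | no n = inj₁ (λ { (lift a , lift b , lift c , lift d) → n (a , b , c , d) })
      ... | yes (xπ , ux , wx , sx) = inj₂ notPartner
        where
        notPartner : (y : Node) → ⟦ onBranch 2 ⇒' (¬' PartnerF) ⟧ (((env W π [n 0 ↦ u ]) [n 1 ↦ x ]) [n 2 ↦ y ])
        notPartner y with decide (y ∈B π)
        ... | no n = inj₁ (λ l → n (lower l))
        ... | yes yπ = inj₂ (λ { (lift ty , (lift xy , nyx) , nz) →
                f x xπ ux (wx , sx) y yπ (partner⇒interval sx (ty , (xy , (λ q → nyx (lift q))) ,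
                  λ { (z , sz , (xz , nzx) , (zy , nyz)) →
                        nz (z , lift sz , (lift xz , λ q → nzx (lower q)) , (lift zy , λ q → nyz (lower q))) })) })

    infinitelyMany⇒meets : ∀ π → InfinitelyMany Z π → MeetsBelow π
    infinitelyMany⇒meets π im u uπ with im (length u)
    ... | m , l , zm = prefix π m , prefix-on π m ,
                       on-⊑ uπ (prefix-on π m) (ℕP.≤-trans l (ℕP.≤-reflexive (sym (prefix-length π m)))) , zm

    meets⇒infinitelyMany : ∀ π → MeetsBelow π → InfinitelyMany Z π
    meets⇒infinitelyMany π f n with f (prefix π n) (prefix-on π n)
    ... | z , zπ , nz , zz = length z , ℕP.≤-trans (ℕP.≤-reflexive (sym (prefix-length π n))) (⊑-length nz) , subst Z zπ zz

    Agree : Branch → Set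
    Agree π = (InfinitelyMany Z π → LimsupInfinite I π) × (LimsupInfinite I π → InfinitelyMany Z π)

    -- Characteristic ⇒ φ, first conjunct: for every W, almost surely Agree
    -- and not Bad W, and these give  HI_W ∧ FC_W → Z∞.
    every-W : Characteristic I Z → (W : Node → Set) →
      ⟦ ∇ 0 ((HitsW ∧' FinitelyCompletedW) ⇒' MeetsZ) ⟧ (ρ₀ [s 3 ↦ W ])
    every-W char W = R , Null-mono split (Null-∪ char (B.bounded-null W)) , R-meets
      where
      R : Branch → Set
      R π = Agree π × ¬ B.Bad W π
      split : ∀ π → ¬ R π → ¬ Agree π ⊎ B.Bad W π
      split π nr with decide (Agree π)
      ... | no na = inj₁ na
      ... | yes a with decide (B.Bad W π)
      ...   | yes b = inj₂ b
      ...   | no nb = ⊥-elim (nr (a , nb))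
      R-meets : (π : Branch) → R π → ⟦ (HitsW ∧' FinitelyCompletedW) ⇒' MeetsZ ⟧ (env W π)
      R-meets π (a , nb) with decide₁ (⟦ HitsW ⟧ (env W π) × ⟦ FinitelyCompletedW ⟧ (env W π))
      ... | no n = inj₁ n
      ... | yes (hi , fc) with decide (LimsupInfinite I π)
      ...   | yes ls = inj₂ (meetsZ-complete W π (infinitelyMany⇒meets π (proj₂ a ls)))
      ...   | no nls = ⊥-elim (nb (nls , hits-sound W π hi , finitelyCompleted-sound W π fc))

    -- second conjunct, witnessed by W = G: almost surely Agree and FC_G,
    -- which give  Z∞ → limsup = ∞ → HI_G.
    greedy-witness : Characteristic I Z →
      ⟦ ∇ 0 (MeetsZ ⇒' (HitsW ∧' FinitelyCompletedW)) ⟧ (ρ₀ [s 3 ↦ G.Greedy ])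
    greedy-witness char = R , Null-mono split (Null-∪ char G.greedy-finitelyCompleted) , R-greedy
      where
      R : Branch → Set
      R π = Agree π × FinitelyCompleted G.Greedy π
      split : ∀ π → ¬ R π → ¬ Agree π ⊎ ¬ FinitelyCompleted G.Greedy π
      split π nr with decide (Agree π)
      ... | no na = inj₁ na
      ... | yes a with decide (FinitelyCompleted G.Greedy π)
      ...   | yes f = ⊥-elim (nr (a , f))
      ...   | no nf = inj₂ nf
      R-greedy : (π : Branch) → R π → ⟦ MeetsZ ⇒' (HitsW ∧' FinitelyCompletedW) ⟧ (env G.Greedy π)
      R-greedy π (a , fc) with decide₁ (⟦ MeetsZ ⟧ (env G.Greedy π))
      ... | no n = inj₁ n
      ... | yes z = inj₂ (hits-complete G.Greedy π (G.limsup⇒hits π (proj₁ a (meets⇒infinitelyMany π (meetsZ-sound G.Greedy π z)))) ,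
                          finitelyCompleted-complete G.Greedy π fc)

    characteristic⇒φ : Characteristic I Z → ⟦ φ ⟧ ρ₀
    characteristic⇒φ char = every-W char , (G.Greedy , greedy-witness char)

    -- Outside four null sets — the exceptional sets of
    -- the two ∇'s (the first instantiated at W = G), the set where FC_G
    -- fails, and Bad for the witness of the second — Agree holds.
    φ⇒characteristic : ⟦ φ ⟧ ρ₀ → Characteristic I Z
    φ⇒characteristic (forEvery , (W , R₂ , R₂-prob , R₂-sound)) =
      Null-mono exceptional (Null-∪ (Null-∪ R₁-prob R₂-prob) (Null-∪ G.greedy-finitelyCompleted (B.bounded-null W)))
      where
      R₁ : Branch → Set
      R₁ = proj₁ (forEvery G.Greedy)
      R₁-prob : ProbOne R₁
      R₁-prob = proj₁ (proj₂ (forEvery G.Greedy))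
      R₁-sound : (π : Branch) → R₁ π → ⟦ (HitsW ∧' FinitelyCompletedW) ⇒' MeetsZ ⟧ (env G.Greedy π)
      R₁-sound = proj₂ (proj₂ (forEvery G.Greedy))
      exceptional : ∀ π → ¬ Agree π → (¬ R₁ π ⊎ ¬ R₂ π) ⊎ (¬ FinitelyCompleted G.Greedy π ⊎ B.Bad W π)
      exceptional π na with decide (InfinitelyMany Z π) | decide (LimsupInfinite I π)
      ... | yes im | yes ls = ⊥-elim (na ((λ _ → ls) , (λ _ → im)))
      ... | no nim | no nls = ⊥-elim (na ((λ im → ⊥-elim (nim im)) , (λ ls → ⊥-elim (nls ls))))
      ... | yes im | no nls with decide (R₂ π)
      ...   | no n = inj₁ (inj₂ n)
      ...   | yes r with R₂-sound π r
      ...     | inj₁ nz = ⊥-elim (nz (meetsZ-complete W π (infinitelyMany⇒meets π im)))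
      ...     | inj₂ (hi , fc) = inj₂ (inj₂ (nls , hits-sound W π hi , finitelyCompleted-sound W π fc))
      exceptional π na | no nim | yes ls with decide (R₁ π)
      ...   | no n = inj₁ (inj₁ n)
      ...   | yes r with decide (FinitelyCompleted G.Greedy π)
      ...     | no nf = inj₂ (inj₁ nf)
      ...     | yes fcg with R₁-sound π r
      ...       | inj₁ n = ⊥-elim (n (hits-complete G.Greedy π (G.limsup⇒hits π ls) , finitelyCompleted-complete G.Greedy π fcg))
      ...       | inj₂ z = ⊥-elim (nim (meets⇒infinitelyMany π (meetsZ-sound G.Greedy π z)))

lemma2 : ExcludedMiddle (lsuc 0ℓ) →
    Σ Formula λ φ →
    (I : Node → Node → Set) → IntervalFamily I → (Z : Node → Set) → (ρ : Env) →
    (⟦ φ ⟧ (((ρ [s 0 ↦ source I ]) [s 1 ↦ target I ]) [s 2 ↦ Z ]) ⇔ Characteristic I Z)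
lemma2 em = Definability.φ , λ I IF Z ρ →
  let open Definability.Meaning em I IF Z ρ in mk⇔ φ⇒characteristic characteristic⇒φ
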